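{- Let $\Sigma$ be a signed graph. Then $\Sigma$ is balanced if and only if $\mathsf E(\Sigma,x)=\mathsf O(\Sigma,x)$.
   Context: A signed graph $\Sigma=(\Gamma,\sigma)$ is a finite simple graph $\Gamma$ with a signature $\sigma:E(\Gamma)\to\{\pm1\}$. $\Sigma$ is balanced if every cycle of $\Gamma$ contains an even number of negative edges. For an integer $\lambda\ge 0$, let $C_\lambda$ be the set of nonzero integers in $[-\lambda/2,\lambda/2]$ if $\lambda$ is even, and the set of integers in $[-(\lambda-1)/2,(\lambda-1)/2]$ if $\lambda$ is odd. A proper $C_\lambda$-colouring of $\Sigma$ is a map $\kappa:V(\Gamma)\to C_\lambda$ with $\kappa(v)\ne\sigma(\{v,w\})\kappa(w)$ for every edge $\{v,w\}$; $f(\Sigma,\lambda)$ denotes their number. $\mathsf E(\Sigma,x),\mathsf O(\Sigma,x)\in\mathbb Z[x]$ are the unique polynomials with $f(\Sigma,\lambda)=\mathsf E(\Sigma,\lambda)$ for all even $\lambda\ge0$ and $f(\Sigma,\lambda)=\mathsf O(\Sigma,\lambda)$ for all odd $\lambda\ge0$. -}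

module Defs where

open import Data.Bool using (Bool; true; false; _∧_; _∨_; not; if_then_else_)
open import Data.Nat as ℕ using (ℕ; zero; suc; _≤_; _∸_; _≡ᵇ_; _≤ᵇ_; _%_)
open import Data.Integer as ℤ using (ℤ; +_; -_; ∣_∣)
open import Data.Fin using (Fin)
open import Data.List using (List; []; _∷_; [_]; map; concatMap; filterᵇ; length; zip; _++_; upTo; lookup)
open import Data.List.Relation.Unary.All using (All)
open import Data.List.Relation.Unary.Unique.Propositional using (Unique)
open import Data.Vec as Vec using (Vec)
open import Data.Product using (_×_; _,_; ∃)
open import Relation.Binary.PropositionalEquality using (_≡_; _≢_)
open import Relation.Nullary using (does)
open import Data.List using (allFin)

data EdgeLabel : Set where
  noEdge pos neg : EdgeLabel

record SignedGraph (n : ℕ) : Set where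
  field
    lab    : Fin n → Fin n → EdgeLabel
    sym    : ∀ i j → lab i j ≡ lab j i
    irrefl : ∀ i → lab i i ≡ noEdge
open SignedGraph public

-- Cycles and balance.
-- A cycle is given by a list v₀ … v_{k-1} of k ≥ 3 distinct vertices with
-- v_i ~ v_{i+1} (indices mod k).  Its edges are the consecutive pairs.

cycleEdges : ∀ {n} → List (Fin n) → List (Fin n × Fin n)
cycleEdges []         = []
cycleEdges (v ∷ rest) = zip (v ∷ rest) (rest ++ [ v ])

isNeg : EdgeLabel → Bool
isNeg neg = true
isNeg _   = false

isEdge : EdgeLabel → Bool
isEdge noEdge = false
isEdge _      = true

IsCycle : ∀ {n} → SignedGraph n → List (Fin n) → Set
IsCycle Σ vs =
  (3 ≤ length vs) × Unique vs ×
  All (λ { (a , b) → lab Σ a b ≢ noEdge }) (cycleEdges vs)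

negCount : ∀ {n} → SignedGraph n → List (Fin n) → ℕ
negCount Σ vs = length (filterᵇ (λ { (a , b) → isNeg (lab Σ a b) }) (cycleEdges vs))

Even : ℕ → Set
Even m = ∃ λ k → m ≡ 2 ℕ.* k

Balanced : ∀ {n} → SignedGraph n → Set
Balanced Σ = ∀ vs → IsCycle Σ vs → Even (negCount Σ vs)

-- The colour sets C_λ ⊆ ℤ, as the paper defines them: among the integers
-- in [-λ, λ], keep z with 2|z| ≤ λ and z ≠ 0 (λ even), resp.
-- 2|z| ≤ λ - 1 (λ odd).

inC : ℕ → ℤ → Bool
inC l z with l % 2 ≡ᵇ 0
... | true  = ((2 ℕ.* ∣ z ∣) ≤ᵇ l) ∧ not (∣ z ∣ ≡ᵇ 0)
... | false = (2 ℕ.* ∣ z ∣) ≤ᵇ (l ∸ 1)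

colours : ℕ → List ℤ
colours l = filterᵇ (inC l) (map (λ k → (+ k) ℤ.- (+ l)) (upTo (suc (2 ℕ.* l))))

assignments : (n : ℕ) → List ℤ → List (Vec ℤ n)
assignments zero    cs = [ Vec.[] ]
assignments (suc n) cs = concatMap (λ c → map (c Vec.∷_) (assignments n cs)) cs

_==ℤ_ : ℤ → ℤ → Bool
x ==ℤ y = does (x ℤ.≟ y)

edgeOK : EdgeLabel → ℤ → ℤ → Bool
edgeOK noEdge x y = true
edgeOK pos    x y = not (x ==ℤ y)
edgeOK neg    x y = not (x ==ℤ (- y))

allB : ∀ {A : Set} → (A → Bool) → List A → Bool
allB p []       = true
allB p (x ∷ xs) = p x ∧ allB p xs

proper : ∀ {n} → SignedGraph n → Vec ℤ n → Bool
proper {n} Σ κ =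
  allB (λ i → allB (λ j → edgeOK (lab Σ i j) (Vec.lookup κ i) (Vec.lookup κ j)) (allFin n)) (allFin n)

f : ∀ {n} → SignedGraph n → ℕ → ℕ
f {n} Σ l = length (filterᵇ (proper Σ) (assignments n (colours l)))

-- Integer polynomials as coefficient lists (constant term first).

Poly : Set
Poly = List ℤ

eval : Poly → ℤ → ℤ
eval []       x = + 0
eval (a ∷ as) x = a ℤ.+ x ℤ.* eval as x

coeff : Poly → ℕ → ℤ
coeff []       _       = + 0
coeff (a ∷ as) zero    = a
coeff (a ∷ as) (suc i) = coeff as i

-- equality of polynomials (coefficientwise; trailing zeros irrelevant)
_≈ₚ_ : Poly → Poly → Set
P ≈ₚ Q = ∀ i → coeff P i ≡ coeff Q i

IsE : ∀ {n} → SignedGraph n → Poly → Set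
IsE Σ P = ∀ m → eval P (+ (2 ℕ.* m)) ≡ + f Σ (2 ℕ.* m)

IsO : ∀ {n} → SignedGraph n → Poly → Set
IsO Σ P = ∀ m → eval P (+ (suc (2 ℕ.* m))) ≡ + f Σ (suc (2 ℕ.* m))

module Submission where

-- Eliminating the vertices one at a time, with inclusion–exclusion over the constraints at the
-- vertex being eliminated, counts the proper colourings from a negation-closed set C by a
-- polynomial in |C| that depends on C only through the multiplicity z of 0 in C; so E and O
-- are this polynomial for z = 0 and z = 1. The parameter z enters only through negative loops
-- created at the eliminated vertex. Such a loop comes from a negative closed walk, hence from a
-- negative cycle, so for balanced Σ the two polynomials coincide. If Σ is unbalanced, no
-- switching function makes all edges positive, and comparing the two recursions at x = -1 term
-- by term gives (-1)ⁿ E(-1) < (-1)ⁿ O(-1).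

open import Defs hiding (sym)
open import Data.Nat using (ℕ)
open import Function.Bundles using (_⇔_)

open import Data.Nat as ℕ using (zero; suc; _≤_; _<_; z≤n; s≤s; _≤ᵇ_; _≡ᵇ_; _%_; _∸_)
import Data.Nat.Properties as ℕP
import Data.Nat.DivMod as ℕD
import Data.Nat.Tactic.RingSolver as ℕSolver
open import Data.Integer as ℤ using (ℤ; +_; -_; -[1+_]; 0ℤ; 1ℤ; -1ℤ; ∣_∣; _^_)
import Data.Integer.Properties as ℤP
open import Data.Integer.Tactic.RingSolver using (solve-∀)
open import Data.Sign as Sign using (Sign)
import Data.Sign.Properties as SignP
open import Data.Bool using (Bool; true; false; _∧_; not; if_then_else_; T)
import Data.Bool.Properties as BoolP
open import Data.Unit using (⊤; tt)
open import Data.Empty using (⊥; ⊥-elim)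
open import Data.Fin as Fin using (Fin; zero; suc)
open import Data.List using (List; []; _∷_; [_]; _++_; map; concatMap; filterᵇ; length; zip; upTo; applyUpTo; allFin)
import Data.List.Properties as ListP
open import Data.List.Relation.Unary.All as All using (All; []; _∷_)
import Data.List.Relation.Unary.All.Properties as AllP
open import Data.List.Relation.Unary.Any as Any using (Any; here; there)
open import Data.List.Relation.Unary.AllPairs using ([]; _∷_)
open import Data.List.Relation.Unary.Unique.Propositional using (Unique)
open import Data.List.Membership.Propositional using (_∈_)
import Data.List.Membership.Propositional.Properties as ∈P
open import Data.Vec using (Vec; lookup) renaming (_∷_ to _∷ᵛ_; [] to []ᵛ)
import Data.Vec.Relation.Unary.All as VecAll
import Data.Vec.Relation.Unary.All.Properties as VecAllP
open import Data.Product using (_×_; _,_; proj₁; proj₂; Σ-syntax)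
open import Data.Sum using (_⊎_; inj₁; inj₂)
open import Function using (_∘_; id)
open import Function.Bundles using (mk⇔; Equivalence)
open import Relation.Nullary using (¬_; yes; no)
open import Relation.Unary using (Decidable)
open import Relation.Binary.PropositionalEquality using (_≡_; _≢_; refl; sym; trans; cong; cong₂; subst; subst₂; module ≡-Reasoning)
open import Algebra.Bundles using (CommutativeMonoid)
open ≡-Reasoning

open import Algebra.Properties.CommutativeSemigroup
  (CommutativeMonoid.commutativeSemigroup BoolP.∧-commutativeMonoid)
  using () renaming (interchange to ∧-interchange)
open import Algebra.Properties.CommutativeSemigroup ℕP.+-commutativeSemigroup
  using () renaming (interchange to +-interchange)

-- Polynomials

infixl 6 _+ₚ_ _-ₚ_
infixr 7 _·ₚ_

_+ₚ_ : Poly → Poly → Poly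
[]      +ₚ q       = q
(a ∷ p) +ₚ []      = a ∷ p
(a ∷ p) +ₚ (b ∷ q) = a ℤ.+ b ∷ p +ₚ q

-ₚ_ : Poly → Poly
-ₚ_ = map -_

_-ₚ_ : Poly → Poly → Poly
p -ₚ q = p +ₚ -ₚ q

_·ₚ_ : ℤ → Poly → Poly
a ·ₚ p = map (a ℤ.*_) p

X*ₚ_ : Poly → Poly
X*ₚ p = 0ℤ ∷ p

eval-+ₚ : ∀ p q x → eval (p +ₚ q) x ≡ eval p x ℤ.+ eval q x
eval-+ₚ []      q       x = sym (ℤP.+-identityˡ _)
eval-+ₚ (a ∷ p) []      x = sym (ℤP.+-identityʳ _)
eval-+ₚ (a ∷ p) (b ∷ q) x = begin
  a ℤ.+ b ℤ.+ x ℤ.* eval (p +ₚ q) x                   ≡⟨ cong (λ e → a ℤ.+ b ℤ.+ x ℤ.* e) (eval-+ₚ p q x) ⟩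
  a ℤ.+ b ℤ.+ x ℤ.* (eval p x ℤ.+ eval q x)           ≡⟨ distribute a b x (eval p x) (eval q x) ⟩
  a ℤ.+ x ℤ.* eval p x ℤ.+ (b ℤ.+ x ℤ.* eval q x)     ∎
  where
  distribute : ∀ a b x u v → a ℤ.+ b ℤ.+ x ℤ.* (u ℤ.+ v) ≡ a ℤ.+ x ℤ.* u ℤ.+ (b ℤ.+ x ℤ.* v)
  distribute = solve-∀

eval-·ₚ : ∀ a p x → eval (a ·ₚ p) x ≡ a ℤ.* eval p x
eval-·ₚ a []      x = sym (ℤP.*-zeroʳ a)
eval-·ₚ a (b ∷ p) x = begin
  a ℤ.* b ℤ.+ x ℤ.* eval (a ·ₚ p) x   ≡⟨ cong (λ e → a ℤ.* b ℤ.+ x ℤ.* e) (eval-·ₚ a p x) ⟩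
  a ℤ.* b ℤ.+ x ℤ.* (a ℤ.* eval p x)  ≡⟨ distribute a b x (eval p x) ⟩
  a ℤ.* (b ℤ.+ x ℤ.* eval p x)        ∎
  where
  distribute : ∀ a b x u → a ℤ.* b ℤ.+ x ℤ.* (a ℤ.* u) ≡ a ℤ.* (b ℤ.+ x ℤ.* u)
  distribute = solve-∀

eval--ₚ : ∀ p q x → eval (p -ₚ q) x ≡ eval p x ℤ.- eval q x
eval--ₚ p q x = begin
  eval (p -ₚ q) x                 ≡⟨ eval-+ₚ p (-ₚ q) x ⟩
  eval p x ℤ.+ eval (-ₚ q) x      ≡⟨ cong (λ e → eval p x ℤ.+ e) (trans (cong (λ r → eval r x) (negate≡scale q)) (eval-·ₚ -1ℤ q x)) ⟩
  eval p x ℤ.+ -1ℤ ℤ.* eval q x   ≡⟨ cong (λ e → eval p x ℤ.+ e) (ℤP.-1*i≡-i (eval q x)) ⟩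
  eval p x ℤ.- eval q x           ∎
  where
  negate≡scale : ∀ q → -ₚ q ≡ -1ℤ ·ₚ q
  negate≡scale []      = refl
  negate≡scale (a ∷ q) = cong₂ _∷_ (sym (ℤP.-1*i≡-i a)) (negate≡scale q)

eval-X*ₚ : ∀ p x → eval (X*ₚ p) x ≡ x ℤ.* eval p x
eval-X*ₚ p x = ℤP.+-identityˡ _

coeff-+ₚ : ∀ p q i → coeff (p +ₚ q) i ≡ coeff p i ℤ.+ coeff q i
coeff-+ₚ []      q       i       = sym (ℤP.+-identityˡ _)
coeff-+ₚ (a ∷ p) []      i       = sym (ℤP.+-identityʳ _)
coeff-+ₚ (a ∷ p) (b ∷ q) zero    = refl
coeff-+ₚ (a ∷ p) (b ∷ q) (suc i) = coeff-+ₚ p q i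

coeff--ₚ : ∀ p q i → coeff (p -ₚ q) i ≡ coeff p i ℤ.- coeff q i
coeff--ₚ p q i = trans (coeff-+ₚ p (-ₚ q) i) (cong (λ c → coeff p i ℤ.+ c) (coeff-negate q i))
  where
  coeff-negate : ∀ q i → coeff (-ₚ q) i ≡ - coeff q i
  coeff-negate []      i       = refl
  coeff-negate (a ∷ q) zero    = refl
  coeff-negate (a ∷ q) (suc i) = coeff-negate q i

eval-zeroPoly : ∀ p → (∀ i → coeff p i ≡ 0ℤ) → ∀ x → eval p x ≡ 0ℤ
eval-zeroPoly []      _     x = refl
eval-zeroPoly (a ∷ p) zeros x = begin
  a ℤ.+ x ℤ.* eval p x  ≡⟨ cong₂ (λ b e → b ℤ.+ x ℤ.* e) (zeros 0) (eval-zeroPoly p (λ i → zeros (suc i)) x) ⟩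
  0ℤ ℤ.+ x ℤ.* 0ℤ       ≡⟨ trans (ℤP.+-identityˡ _) (ℤP.*-zeroʳ x) ⟩
  0ℤ                    ∎

-- If a + x·b = 0 then |a| = x·|b|, so |a| < x forces b = 0 and hence a = 0.
small-constant-term : ∀ a b (x : ℕ) → ∣ a ∣ < x → a ℤ.+ + x ℤ.* b ≡ 0ℤ → a ≡ 0ℤ
small-constant-term a b x |a|<x a+xb≡0 =
  ℤP.∣i∣≡0⇒i≡0 (trans |a|≡x|b| (trans (cong (x ℕ.*_) |b|≡0) (ℕP.*-zeroʳ x)))
  where
  |a|≡x|b| : ∣ a ∣ ≡ x ℕ.* ∣ b ∣
  |a|≡x|b| = begin
    ∣ a ∣                 ≡⟨ cong ∣_∣ (ℤP.i-j≡0⇒i≡j a (- (+ x ℤ.* b)) (trans (cong (λ e → a ℤ.+ e) (ℤP.neg-involutive _)) a+xb≡0)) ⟩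
    ∣ - (+ x ℤ.* b) ∣     ≡⟨ ℤP.∣-i∣≡∣i∣ (+ x ℤ.* b) ⟩
    ∣ + x ℤ.* b ∣         ≡⟨ ℤP.abs-* (+ x) b ⟩
    x ℕ.* ∣ b ∣           ∎
  |b|≡0 : ∣ b ∣ ≡ 0
  |b|≡0 = ℕP.n<1⇒n≡0 (ℕP.*-cancelˡ-< x ∣ b ∣ 1
            (subst₂ _<_ |a|≡x|b| (sym (ℕP.*-identityʳ x)) |a|<x))

vanishing⇒zeroPoly : (t : ℕ → ℕ) → (∀ m → m < t m) →
                     ∀ p → (∀ m → eval p (+ t m) ≡ 0ℤ) → ∀ i → coeff p i ≡ 0ℤ
vanishing⇒zeroPoly t m<tm []      _      i       = refl
vanishing⇒zeroPoly t m<tm (a ∷ p) vanish zero    = a≡0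
  where
  a≡0 : a ≡ 0ℤ
  a≡0 = small-constant-term a (eval p (+ t ∣ a ∣)) (t ∣ a ∣) (m<tm ∣ a ∣) (vanish ∣ a ∣)
vanishing⇒zeroPoly t m<tm (a ∷ p) vanish (suc i) = vanishing⇒zeroPoly t m<tm p tail-vanish i
  where
  a≡0 : a ≡ 0ℤ
  a≡0 = vanishing⇒zeroPoly t m<tm (a ∷ p) vanish 0
  tail-vanish : ∀ m → eval p (+ t m) ≡ 0ℤ
  tail-vanish m with ℤP.i*j≡0⇒i≡0∨j≡0 (+ t m)
                       (trans (sym (ℤP.+-identityˡ _)) (trans (cong (λ c → c ℤ.+ _) (sym a≡0)) (vanish m)))
  ... | inj₁ tm≡0 = ⊥-elim (ℕP.n≮0 (subst (m <_) (ℤP.+-injective tm≡0) (m<tm m)))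
  ... | inj₂ e    = e

agree-on-unbounded⇒≈ₚ : (t : ℕ → ℕ) → (∀ m → m < t m) →
                        ∀ p q → (∀ m → eval p (+ t m) ≡ eval q (+ t m)) → p ≈ₚ q
agree-on-unbounded⇒≈ₚ t m<tm p q agree i =
  ℤP.i-j≡0⇒i≡j _ _ (trans (sym (coeff--ₚ p q i)) (vanishing⇒zeroPoly t m<tm (p -ₚ q) difference-vanishes i))
  where
  difference-vanishes : ∀ m → eval (p -ₚ q) (+ t m) ≡ 0ℤ
  difference-vanishes m = trans (eval--ₚ p q _) (ℤP.i≡j⇒i-j≡0 (agree m))

≈ₚ⇒eval≡ : ∀ p q → p ≈ₚ q → ∀ x → eval p x ≡ eval q x
≈ₚ⇒eval≡ p q p≈q x = ℤP.i-j≡0⇒i≡j _ _ (trans (sym (eval--ₚ p q x)) (eval-zeroPoly (p -ₚ q) difference-zero x))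
  where
  difference-zero : ∀ i → coeff (p -ₚ q) i ≡ 0ℤ
  difference-zero i = trans (coeff--ₚ p q i) (ℤP.i≡j⇒i-j≡0 (p≈q i))


-- Signs acting on integers

s*[s*t]≡t : ∀ s t → s Sign.* (s Sign.* t) ≡ t
s*[s*t]≡t s t = trans (sym (SignP.*-assoc s s t)) (cong (Sign._* t) (SignP.s*s≡+ s))

telescope : ∀ a b c → (a Sign.* b) Sign.* (b Sign.* c) ≡ a Sign.* c
telescope a b c = trans (SignP.*-assoc a b (b Sign.* c)) (cong (a Sign.*_) (s*[s*t]≡t b c))

s≢t⇒s*t≡- : ∀ s t → s ≢ t → s Sign.* t ≡ Sign.-
s≢t⇒s*t≡- Sign.+ Sign.- _   = refl
s≢t⇒s*t≡- Sign.- Sign.+ _   = refl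
s≢t⇒s*t≡- Sign.+ Sign.+ s≢t = ⊥-elim (s≢t refl)
s≢t⇒s*t≡- Sign.- Sign.- s≢t = ⊥-elim (s≢t refl)

infixr 25 _⊙_

_⊙_ : Sign → ℤ → ℤ
Sign.+ ⊙ x = x
Sign.- ⊙ x = - x

*-⊙ : ∀ s t x → (s Sign.* t) ⊙ x ≡ s ⊙ t ⊙ x
*-⊙ Sign.+ t       x = refl
*-⊙ Sign.- Sign.+ x = refl
*-⊙ Sign.- Sign.- x = sym (ℤP.neg-involutive x)

⊙-involutive : ∀ s x → s ⊙ s ⊙ x ≡ x
⊙-involutive s x = trans (sym (*-⊙ s s x)) (cong (_⊙ x) (SignP.s*s≡+ s))

⊙-comm : ∀ s t x → s ⊙ t ⊙ x ≡ t ⊙ s ⊙ x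
⊙-comm s t x = trans (sym (*-⊙ s t x)) (trans (cong (_⊙ x) (SignP.*-comm s t)) (*-⊙ t s x))

⊙-injective : ∀ s {x y} → s ⊙ x ≡ s ⊙ y → x ≡ y
⊙-injective Sign.+ e = e
⊙-injective Sign.- e = ℤP.neg-injective e

⊙-zero : ∀ s → s ⊙ 0ℤ ≡ 0ℤ
⊙-zero Sign.+ = refl
⊙-zero Sign.- = refl

T-injective : ∀ {b c} → (T b → T c) → (T c → T b) → b ≡ c
T-injective {false} {false} _   _   = refl
T-injective {false} {true}  _   c⇒b = ⊥-elim (c⇒b tt)
T-injective {true}  {false} b⇒c _   = ⊥-elim (b⇒c tt)
T-injective {true}  {true}  _   _   = refl

==ℤ⇒≡ : ∀ {x y} → T (x ==ℤ y) → x ≡ y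
==ℤ⇒≡ {x} {y} x==y with x ℤ.≟ y
... | yes x≡y = x≡y

≡⇒==ℤ : ∀ {x y} → x ≡ y → T (x ==ℤ y)
≡⇒==ℤ {x} {y} x≡y with x ℤ.≟ y
... | yes _  = tt
... | no x≢y = x≢y x≡y

==ℤ-refl : ∀ x → (x ==ℤ x) ≡ true
==ℤ-refl x = T-injective (λ _ → tt) (λ _ → ≡⇒==ℤ {x} refl)

==ℤ-cong : ∀ {x y u v} → (x ≡ y → u ≡ v) → (u ≡ v → x ≡ y) → (x ==ℤ y) ≡ (u ==ℤ v)
==ℤ-cong ⇒ ⇐ = T-injective (≡⇒==ℤ ∘ ⇒ ∘ ==ℤ⇒≡) (≡⇒==ℤ ∘ ⇐ ∘ ==ℤ⇒≡)

==ℤ-⊙-swap : ∀ s x y → (y ==ℤ s ⊙ x) ≡ (x ==ℤ s ⊙ y)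
==ℤ-⊙-swap s x y = ==ℤ-cong (move x y) (move y x)
  where
  move : ∀ x y → y ≡ s ⊙ x → x ≡ s ⊙ y
  move x y y≡sx = trans (sym (⊙-involutive s x)) (cong (s ⊙_) (sym y≡sx))

==ℤ-⊙-cancel : ∀ s x y → (s ⊙ x ==ℤ s ⊙ y) ≡ (x ==ℤ y)
==ℤ-⊙-cancel s x y = ==ℤ-cong (⊙-injective s) (cong (s ⊙_))

self-negative : ∀ x → (x ==ℤ (- x)) ≡ (x ==ℤ 0ℤ)
self-negative x = ==ℤ-cong (fixed⇒zero x) (λ x≡0 → trans x≡0 (cong -_ (sym x≡0)))
  where
  fixed⇒zero : ∀ x → x ≡ - x → x ≡ 0ℤ
  fixed⇒zero (+ zero)   _  = refl
  fixed⇒zero (+ suc n)  ()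
  fixed⇒zero -[1+ n ]   ()

allB-++ : ∀ {A : Set} (p : A → Bool) xs ys → allB p (xs ++ ys) ≡ allB p xs ∧ allB p ys
allB-++ p []       ys = refl
allB-++ p (x ∷ xs) ys = trans (cong (p x ∧_) (allB-++ p xs ys)) (sym (BoolP.∧-assoc (p x) _ _))

allB-concatMap : ∀ {A B : Set} (p : B → Bool) (f : A → List B) xs →
                 allB p (concatMap f xs) ≡ allB (λ x → allB p (f x)) xs
allB-concatMap p f []       = refl
allB-concatMap p f (x ∷ xs) = trans (allB-++ p (f x) (concatMap f xs)) (cong (allB p (f x) ∧_) (allB-concatMap p f xs))

allB-∧ : ∀ {A : Set} (p q : A → Bool) xs → allB (λ x → p x ∧ q x) xs ≡ allB p xs ∧ allB q xs
allB-∧ p q []       = refl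
allB-∧ p q (x ∷ xs) = trans (cong ((p x ∧ q x) ∧_) (allB-∧ p q xs)) (∧-interchange (p x) (q x) _ _)

allB-cong : ∀ {A : Set} {p q : A → Bool} xs → (∀ x → p x ≡ q x) → allB p xs ≡ allB q xs
allB-cong []       p≗q = refl
allB-cong (x ∷ xs) p≗q = cong₂ _∧_ (p≗q x) (allB-cong xs p≗q)

All-concatMap⁺ : ∀ {A B : Set} {P : A → Set} {Q : B → Set} {f : A → List B} →
                 (∀ {x} → P x → All Q (f x)) → ∀ {xs} → All P xs → All Q (concatMap f xs)
All-concatMap⁺ P⇒Q ps = AllP.concat⁺ (AllP.map⁺ (All.map P⇒Q ps))

-- Constraint systems and their counting polynomials

infix 4 _≠[_]_

data Constraint (n : ℕ) : Set where
  _≠[_]_        : Fin n → Sign → Fin n → Constraint n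
  unsatisfiable : Constraint n

data Pivot (n : ℕ) : Set where
  loop : Sign → Pivot n
  to   : Fin n → Sign → Pivot n

holds : ∀ {n} → Vec ℤ n → Constraint n → Bool
holds κ (a ≠[ s ] b)  = not (lookup κ a ==ℤ s ⊙ lookup κ b)
holds κ unsatisfiable = false

holdsᵖ : ∀ {n} → Vec ℤ (suc n) → Pivot n → Bool
holdsᵖ (x ∷ᵛ κ) (loop s) = not (x ==ℤ s ⊙ x)
holdsᵖ (x ∷ᵛ κ) (to w s) = not (x ==ℤ s ⊙ lookup κ w)

Solves : ∀ {n} → Vec ℤ n → List (Constraint n) → Bool
Solves κ = allB (holds κ)

pivots : ∀ {n} → Constraint (suc n) → List (Pivot n)
pivots (zero  ≠[ s ] zero)  = [ loop s ]
pivots (zero  ≠[ s ] suc b) = [ to b s ]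
pivots (suc a ≠[ s ] zero)  = [ to a s ]
pivots (suc a ≠[ s ] suc b) = []
pivots unsatisfiable        = []

residue : ∀ {n} → Constraint (suc n) → List (Constraint n)
residue (zero  ≠[ s ] b)     = []
residue (suc a ≠[ s ] zero)  = []
residue (suc a ≠[ s ] suc b) = [ a ≠[ s ] b ]
residue unsatisfiable        = [ unsatisfiable ]

substitute : ∀ {n} → Fin n → Sign → Pivot n → Constraint n
substitute w s (loop t) = w ≠[ t ] w
substitute w s (to u t) = w ≠[ s Sign.* t ] u

substituteZero : ∀ {n} → Pivot n → Constraint n
substituteZero (loop t) = unsatisfiable
substituteZero (to u t) = u ≠[ Sign.- ] u

holds-split : ∀ {n} x (κ : Vec ℤ n) c →
              holds (x ∷ᵛ κ) c ≡ allB (holdsᵖ (x ∷ᵛ κ)) (pivots c) ∧ Solves κ (residue c)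
holds-split x κ (zero  ≠[ s ] zero)  = sym (trans (BoolP.∧-identityʳ _) (BoolP.∧-identityʳ _))
holds-split x κ (zero  ≠[ s ] suc b) = sym (trans (BoolP.∧-identityʳ _) (BoolP.∧-identityʳ _))
holds-split x κ (suc a ≠[ s ] zero)  =
  trans (cong not (==ℤ-⊙-swap s x (lookup κ a))) (sym (trans (BoolP.∧-identityʳ _) (BoolP.∧-identityʳ _)))
holds-split x κ (suc a ≠[ s ] suc b) = sym (BoolP.∧-identityʳ _)
holds-split x κ unsatisfiable        = refl

Solves-split : ∀ {n} x (κ : Vec ℤ n) cs →
               Solves (x ∷ᵛ κ) cs ≡ allB (holdsᵖ (x ∷ᵛ κ)) (concatMap pivots cs) ∧ Solves κ (concatMap residue cs)
Solves-split x κ cs = begin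
  Solves (x ∷ᵛ κ) cs
    ≡⟨ allB-cong cs (holds-split x κ) ⟩
  allB (λ c → allB (holdsᵖ (x ∷ᵛ κ)) (pivots c) ∧ Solves κ (residue c)) cs
    ≡⟨ allB-∧ _ _ cs ⟩
  allB (λ c → allB (holdsᵖ (x ∷ᵛ κ)) (pivots c)) cs ∧ allB (λ c → Solves κ (residue c)) cs
    ≡⟨ sym (cong₂ _∧_ (allB-concatMap _ pivots cs) (allB-concatMap _ residue cs)) ⟩
  allB (holdsᵖ (x ∷ᵛ κ)) (concatMap pivots cs) ∧ Solves κ (concatMap residue cs)
    ∎

holdsᵖ-substitute : ∀ {n} w s (κ : Vec ℤ n) p → holdsᵖ (s ⊙ lookup κ w ∷ᵛ κ) p ≡ holds κ (substitute w s p)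
holdsᵖ-substitute w s κ (loop t) = cong not (begin
  s ⊙ y ==ℤ t ⊙ s ⊙ y  ≡⟨ cong (s ⊙ y ==ℤ_) (⊙-comm t s y) ⟩
  s ⊙ y ==ℤ s ⊙ t ⊙ y  ≡⟨ ==ℤ-⊙-cancel s y (t ⊙ y) ⟩
  y ==ℤ t ⊙ y          ∎)
  where y = lookup κ w
holdsᵖ-substitute w s κ (to u t) = cong not (begin
  s ⊙ y ==ℤ t ⊙ v          ≡⟨ cong (s ⊙ y ==ℤ_) (sym (⊙-involutive s (t ⊙ v))) ⟩
  s ⊙ y ==ℤ s ⊙ s ⊙ t ⊙ v  ≡⟨ ==ℤ-⊙-cancel s y (s ⊙ t ⊙ v) ⟩
  y ==ℤ s ⊙ t ⊙ v          ≡⟨ cong (y ==ℤ_) (sym (*-⊙ s t v)) ⟩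
  y ==ℤ (s Sign.* t) ⊙ v   ∎)
  where y = lookup κ w
        v = lookup κ u

holdsᵖ-substituteZero : ∀ {n} (κ : Vec ℤ n) p → holdsᵖ (0ℤ ∷ᵛ κ) p ≡ holds κ (substituteZero p)
holdsᵖ-substituteZero κ (loop t) = cong not (trans (cong (0ℤ ==ℤ_) (⊙-zero t)) (==ℤ-refl 0ℤ))
holdsᵖ-substituteZero κ (to u t) = cong not (begin
  0ℤ ==ℤ t ⊙ v     ≡⟨ ==ℤ-cong (λ 0≡tv → ⊙-injective t (trans (sym 0≡tv) (sym (⊙-zero t))))
                              (λ v≡0 → sym (trans (cong (t ⊙_) v≡0) (⊙-zero t))) ⟩
  v ==ℤ 0ℤ         ≡⟨ sym (self-negative v) ⟩
  v ==ℤ (- v)      ∎)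
  where v = lookup κ u

Solves-substitute : ∀ {n} (sub : Pivot n → Constraint n) x (κ : Vec ℤ n) →
                    (∀ p → holdsᵖ (x ∷ᵛ κ) p ≡ holds κ (sub p)) →
                    ∀ T R → allB (holdsᵖ (x ∷ᵛ κ)) T ∧ Solves κ R ≡ Solves κ (map sub T ++ R)
Solves-substitute sub x κ sem []      R = refl
Solves-substitute sub x κ sem (p ∷ T) R =
  trans (BoolP.∧-assoc (holdsᵖ (x ∷ᵛ κ) p) _ _) (cong₂ _∧_ (sem p) (Solves-substitute sub x κ sem T R))

-- Evaluated at |C|, countPoly z counts the solutions with values in a list C that is closed
-- under negation and contains 0 exactly z times (Counting.countPoly-counts). The pivots of x₀
-- are peeled off one at a time: the assignments violating a pivot fix x₀ as s·x_w or as 0.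
mutual
  countPoly : ℤ → (n : ℕ) → List (Constraint n) → Poly
  countPoly z zero    cs = if Solves []ᵛ cs then + 1 ∷ [] else []
  countPoly z (suc n) cs = countPolyᵖ z n (concatMap pivots cs) (concatMap residue cs)

  countPolyᵖ : ℤ → (n : ℕ) → List (Pivot n) → List (Constraint n) → Poly
  countPolyᵖ z n []                 R = X*ₚ countPoly z n R
  countPolyᵖ z n (to w s ∷ T)       R = countPolyᵖ z n T R -ₚ countPoly z n (map (substitute w s) T ++ R)
  countPolyᵖ z n (loop Sign.+ ∷ T)  R = []
  countPolyᵖ z n (loop Sign.- ∷ T)  R = countPolyᵖ z n T R -ₚ z ·ₚ countPoly z n (map substituteZero T ++ R)

-- Counting solutions

𝟙 : Bool → ℕ
𝟙 true  = 1
𝟙 false = 0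

∑ : ∀ {A : Set} → List A → (A → ℕ) → ℕ
∑ []      F = 0
∑ (c ∷ C) F = F c ℕ.+ ∑ C F

∑ⁿ : ∀ {A : Set} → List A → (n : ℕ) → (Vec A n → ℕ) → ℕ
∑ⁿ C zero    h = h []ᵛ
∑ⁿ C (suc n) h = ∑ C (λ c → ∑ⁿ C n (λ κ → h (c ∷ᵛ κ)))

multiplicity : List ℤ → ℤ → ℕ
multiplicity C a = ∑ C (λ c → 𝟙 (c ==ℤ a))

Symmetric : List ℤ → Set
Symmetric C = ∀ {c} → c ∈ C → multiplicity C c ≡ 1 × multiplicity C (- c) ≡ 1

∑-cong : ∀ {A : Set} (C : List A) {F G} → (∀ {c} → c ∈ C → F c ≡ G c) → ∑ C F ≡ ∑ C G
∑-cong []      F≗G = refl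
∑-cong (c ∷ C) F≗G = cong₂ ℕ._+_ (F≗G (here refl)) (∑-cong C (λ c∈C → F≗G (there c∈C)))

∑-+ : ∀ {A : Set} (C : List A) F G → ∑ C (λ c → F c ℕ.+ G c) ≡ ∑ C F ℕ.+ ∑ C G
∑-+ []      F G = refl
∑-+ (c ∷ C) F G = trans (cong (F c ℕ.+ G c ℕ.+_) (∑-+ C F G)) (+-interchange (F c) (G c) _ _)

∑-zero : ∀ {A : Set} (C : List A) → ∑ C (λ _ → 0) ≡ 0
∑-zero []      = refl
∑-zero (c ∷ C) = ∑-zero C

∑-const : ∀ {A : Set} (C : List A) k → ∑ C (λ _ → k) ≡ length C ℕ.* k
∑-const []      k = refl
∑-const (c ∷ C) k = cong (k ℕ.+_) (∑-const C k)

∑-*ʳ : ∀ {A : Set} (C : List A) F k → ∑ C (λ c → F c ℕ.* k) ≡ ∑ C F ℕ.* k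
∑-*ʳ []      F k = refl
∑-*ʳ (c ∷ C) F k = trans (cong (F c ℕ.* k ℕ.+_) (∑-*ʳ C F k)) (sym (ℕP.*-distribʳ-+ k (F c) _))

∑-++ : ∀ {A : Set} (xs ys : List A) F → ∑ (xs ++ ys) F ≡ ∑ xs F ℕ.+ ∑ ys F
∑-++ []       ys F = refl
∑-++ (x ∷ xs) ys F = trans (cong (F x ℕ.+_) (∑-++ xs ys F)) (sym (ℕP.+-assoc (F x) _ _))

∑-map : ∀ {A B : Set} (f : A → B) xs F → ∑ (map f xs) F ≡ ∑ xs (λ x → F (f x))
∑-map f []       F = refl
∑-map f (x ∷ xs) F = cong (F (f x) ℕ.+_) (∑-map f xs F)

∑-concatMap : ∀ {A B : Set} (f : A → List B) xs F → ∑ (concatMap f xs) F ≡ ∑ xs (λ x → ∑ (f x) F)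
∑-concatMap f []       F = refl
∑-concatMap f (x ∷ xs) F = trans (∑-++ (f x) (concatMap f xs) F) (cong (∑ (f x) F ℕ.+_) (∑-concatMap f xs F))

∑-filterᵇ : ∀ {A : Set} (q r : A → Bool) xs → ∑ (filterᵇ q xs) (λ x → 𝟙 (r x)) ≡ ∑ xs (λ x → 𝟙 (q x ∧ r x))
∑-filterᵇ q r []       = refl
∑-filterᵇ q r (x ∷ xs) with q x
... | true  = cong (𝟙 (r x) ℕ.+_) (∑-filterᵇ q r xs)
... | false = ∑-filterᵇ q r xs

length-filterᵇ : ∀ {A : Set} (q : A → Bool) xs → length (filterᵇ q xs) ≡ ∑ xs (λ x → 𝟙 (q x))
length-filterᵇ q []       = refl
length-filterᵇ q (x ∷ xs) with q x
... | true  = cong suc (length-filterᵇ q xs)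
... | false = length-filterᵇ q xs

∑-select : ∀ C a (Q : ℤ → Bool) → ∑ C (λ c → 𝟙 ((c ==ℤ a) ∧ Q c)) ≡ 𝟙 (Q a) ℕ.* multiplicity C a
∑-select []      a Q = sym (ℕP.*-zeroʳ (𝟙 (Q a)))
∑-select (c ∷ C) a Q with c ℤ.≟ a
... | yes refl = trans (cong (𝟙 (Q c) ℕ.+_) (∑-select C c Q)) (sym (ℕP.*-suc (𝟙 (Q c)) _))
... | no _     = ∑-select C a Q

∑ⁿ-cong : ∀ {A : Set} (C : List A) n {h h′} → (∀ {κ} → VecAll.All (_∈ C) κ → h κ ≡ h′ κ) → ∑ⁿ C n h ≡ ∑ⁿ C n h′
∑ⁿ-cong C zero    h≗h′ = h≗h′ VecAll.[]
∑ⁿ-cong C (suc n) h≗h′ = ∑-cong C (λ c∈C → ∑ⁿ-cong C n (λ κ∈ → h≗h′ (c∈C VecAll.∷ κ∈)))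

∑ⁿ-+ : ∀ {A : Set} (C : List A) n h h′ → ∑ⁿ C n (λ κ → h κ ℕ.+ h′ κ) ≡ ∑ⁿ C n h ℕ.+ ∑ⁿ C n h′
∑ⁿ-+ C zero    h h′ = refl
∑ⁿ-+ C (suc n) h h′ = trans (∑-cong C (λ _ → ∑ⁿ-+ C n _ _)) (∑-+ C _ _)

∑ⁿ-zero : ∀ {A : Set} (C : List A) n → ∑ⁿ C n (λ _ → 0) ≡ 0
∑ⁿ-zero C zero    = refl
∑ⁿ-zero C (suc n) = trans (∑-cong C (λ _ → ∑ⁿ-zero C n)) (∑-zero C)

∑ⁿ-*ʳ : ∀ {A : Set} (C : List A) n h k → ∑ⁿ C n (λ κ → h κ ℕ.* k) ≡ ∑ⁿ C n h ℕ.* k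
∑ⁿ-*ʳ C zero    h k = refl
∑ⁿ-*ʳ C (suc n) h k = trans (∑-cong C (λ _ → ∑ⁿ-*ʳ C n _ k)) (∑-*ʳ C _ k)

∑-∑ⁿ-comm : ∀ {A B : Set} (C : List A) (D : List B) n (H : B → Vec A n → ℕ) → ∑ D (λ c → ∑ⁿ C n (H c)) ≡ ∑ⁿ C n (λ κ → ∑ D (λ c → H c κ))
∑-∑ⁿ-comm C []      n H = sym (∑ⁿ-zero C n)
∑-∑ⁿ-comm C (d ∷ D) n H = trans (cong (∑ⁿ C n (H d) ℕ.+_) (∑-∑ⁿ-comm C D n H)) (sym (∑ⁿ-+ C n _ _))

𝟙-split : ∀ p b → 𝟙 b ≡ 𝟙 (p ∧ b) ℕ.+ 𝟙 (not p ∧ b)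
𝟙-split true  b = sym (ℕP.+-identityʳ _)
𝟙-split false b = refl

private
  subtract-count : ∀ {a b} c → a ≡ b ℕ.+ c → + a ℤ.- + c ≡ + b
  subtract-count {b = b} c refl = trans (cong (ℤ._- + c) (ℤP.pos-+ b c)) (cancel (+ b) (+ c))
    where
    cancel : ∀ x y → x ℤ.+ y ℤ.- y ≡ x
    cancel = solve-∀

module Counting (C : List ℤ) (symmetric : Symmetric C) where

  Solvesᵖ : ∀ {n} → List (Pivot n) → List (Constraint n) → ℤ → Vec ℤ n → Bool
  Solvesᵖ T R x κ = allB (holdsᵖ (x ∷ᵛ κ)) T ∧ Solves κ R

  #_ : ∀ {n} → List (Constraint n) → ℕ
  #_ {n} cs = ∑ⁿ C n (λ κ → 𝟙 (Solves κ cs))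

  #ᵖ : ∀ {n} → List (Pivot n) → List (Constraint n) → ℕ
  #ᵖ {n} T R = ∑ C (λ x → ∑ⁿ C n (λ κ → 𝟙 (Solvesᵖ T R x κ)))

  #-split : ∀ {n} (cs : List (Constraint (suc n))) → # cs ≡ #ᵖ (concatMap pivots cs) (concatMap residue cs)
  #-split {n} cs = ∑-cong C (λ {x} _ → ∑ⁿ-cong C n (λ {κ} _ → cong 𝟙 (Solves-split x κ cs)))

  #ᵖ-[] : ∀ {n} (R : List (Constraint n)) → #ᵖ [] R ≡ length C ℕ.* # R
  #ᵖ-[] R = ∑-const C (# R)

  #ᵖ-loop⁺ : ∀ {n} T (R : List (Constraint n)) → #ᵖ (loop Sign.+ ∷ T) R ≡ 0
  #ᵖ-loop⁺ {n} T R = trans (∑-cong C (λ {x} _ → trans (∑ⁿ-cong C n (λ {κ} _ → x≠x-fails x κ)) (∑ⁿ-zero C n))) (∑-zero C)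
    where
    x≠x-fails : ∀ x κ → 𝟙 (Solvesᵖ (loop Sign.+ ∷ T) R x κ) ≡ 0
    x≠x-fails x κ = cong (λ b → 𝟙 ((not b ∧ allB (holdsᵖ (x ∷ᵛ κ)) T) ∧ Solves κ R)) (==ℤ-refl x)

  #violating : ∀ {n} → Pivot n → List (Pivot n) → List (Constraint n) → ℕ
  #violating {n} p T R = ∑ C (λ x → ∑ⁿ C n (λ κ → 𝟙 (not (holdsᵖ (x ∷ᵛ κ) p) ∧ Solvesᵖ T R x κ)))

  #ᵖ-peel : ∀ {n} p T (R : List (Constraint n)) → #ᵖ T R ≡ #ᵖ (p ∷ T) R ℕ.+ #violating p T R
  #ᵖ-peel {n} p T R = begin
    #ᵖ T R
      ≡⟨ ∑-cong C (λ {x} _ → ∑ⁿ-cong C n (λ {κ} _ → 𝟙-split (holdsᵖ (x ∷ᵛ κ) p) (Solvesᵖ T R x κ))) ⟩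
    ∑ C (λ x → ∑ⁿ C n (λ κ → 𝟙 (holdsᵖ (x ∷ᵛ κ) p ∧ Solvesᵖ T R x κ) ℕ.+ 𝟙 (not (holdsᵖ (x ∷ᵛ κ) p) ∧ Solvesᵖ T R x κ)))
      ≡⟨ ∑-cong C (λ _ → ∑ⁿ-+ C n _ _) ⟩
    ∑ C (λ x → ∑ⁿ C n (λ κ → 𝟙 (holdsᵖ (x ∷ᵛ κ) p ∧ Solvesᵖ T R x κ)) ℕ.+ ∑ⁿ C n (λ κ → 𝟙 (not (holdsᵖ (x ∷ᵛ κ) p) ∧ Solvesᵖ T R x κ)))
      ≡⟨ ∑-+ C _ _ ⟩
    ∑ C (λ x → ∑ⁿ C n (λ κ → 𝟙 (holdsᵖ (x ∷ᵛ κ) p ∧ Solvesᵖ T R x κ))) ℕ.+ #violating p T R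
      ≡⟨ cong (ℕ._+ #violating p T R) (∑-cong C (λ {x} _ → ∑ⁿ-cong C n (λ {κ} _ → cong 𝟙 (sym (BoolP.∧-assoc (holdsᵖ (x ∷ᵛ κ) p) _ _))))) ⟩
    #ᵖ (p ∷ T) R ℕ.+ #violating p T R
      ∎

  -- The assignments violating p are those with x = a κ; summing over x first
  -- picks out the single value a κ, with its multiplicity in C.
  violations : ∀ {n} p T (R : List (Constraint n)) (a : Vec ℤ n → ℤ) →
               (∀ x κ → not (holdsᵖ (x ∷ᵛ κ) p) ≡ (x ==ℤ a κ)) →
               #violating p T R ≡ ∑ⁿ C n (λ κ → 𝟙 (Solvesᵖ T R (a κ) κ) ℕ.* multiplicity C (a κ))
  violations {n} p T R a violated = begin
    #violating p T R
      ≡⟨ ∑-cong C (λ {x} _ → ∑ⁿ-cong C n (λ {κ} _ → cong (λ b → 𝟙 (b ∧ Solvesᵖ T R x κ)) (violated x κ))) ⟩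
    ∑ C (λ x → ∑ⁿ C n (λ κ → 𝟙 ((x ==ℤ a κ) ∧ Solvesᵖ T R x κ)))
      ≡⟨ ∑-∑ⁿ-comm C C n _ ⟩
    ∑ⁿ C n (λ κ → ∑ C (λ x → 𝟙 ((x ==ℤ a κ) ∧ Solvesᵖ T R x κ)))
      ≡⟨ ∑ⁿ-cong C n (λ {κ} _ → ∑-select C (a κ) (λ x → Solvesᵖ T R x κ)) ⟩
    ∑ⁿ C n (λ κ → 𝟙 (Solvesᵖ T R (a κ) κ) ℕ.* multiplicity C (a κ))
      ∎

  #ᵖ-to : ∀ {n} w s T (R : List (Constraint n)) → #ᵖ T R ≡ #ᵖ (to w s ∷ T) R ℕ.+ # (map (substitute w s) T ++ R)
  #ᵖ-to {n} w s T R = trans (#ᵖ-peel (to w s) T R) (cong (#ᵖ (to w s ∷ T) R ℕ.+_) (begin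
    #violating (to w s) T R
      ≡⟨ violations (to w s) T R (λ κ → s ⊙ lookup κ w) (λ x κ → BoolP.not-involutive _) ⟩
    ∑ⁿ C n (λ κ → 𝟙 (Solvesᵖ T R (s ⊙ lookup κ w) κ) ℕ.* multiplicity C (s ⊙ lookup κ w))
      ≡⟨ ∑ⁿ-cong C n (λ {κ} κ∈C → trans (cong (𝟙 (Solvesᵖ T R (s ⊙ lookup κ w) κ) ℕ.*_) (once s (VecAllP.lookup⁺ κ∈C w))) (ℕP.*-identityʳ _)) ⟩
    ∑ⁿ C n (λ κ → 𝟙 (Solvesᵖ T R (s ⊙ lookup κ w) κ))
      ≡⟨ ∑ⁿ-cong C n (λ {κ} _ → cong 𝟙 (Solves-substitute (substitute w s) _ κ (holdsᵖ-substitute w s κ) T R)) ⟩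
    # (map (substitute w s) T ++ R)
      ∎))
    where
    once : ∀ s {c} → c ∈ C → multiplicity C (s ⊙ c) ≡ 1
    once Sign.+ c∈C = proj₁ (symmetric c∈C)
    once Sign.- c∈C = proj₂ (symmetric c∈C)

  #ᵖ-loop⁻ : ∀ {n} T (R : List (Constraint n)) →
             #ᵖ T R ≡ #ᵖ (loop Sign.- ∷ T) R ℕ.+ # (map substituteZero T ++ R) ℕ.* multiplicity C 0ℤ
  #ᵖ-loop⁻ {n} T R = trans (#ᵖ-peel (loop Sign.-) T R) (cong (#ᵖ (loop Sign.- ∷ T) R ℕ.+_) (begin
    #violating (loop Sign.-) T R
      ≡⟨ violations (loop Sign.-) T R (λ _ → 0ℤ) (λ x κ → trans (BoolP.not-involutive _) (self-negative x)) ⟩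
    ∑ⁿ C n (λ κ → 𝟙 (Solvesᵖ T R 0ℤ κ) ℕ.* multiplicity C 0ℤ)
      ≡⟨ ∑ⁿ-*ʳ C n _ _ ⟩
    ∑ⁿ C n (λ κ → 𝟙 (Solvesᵖ T R 0ℤ κ)) ℕ.* multiplicity C 0ℤ
      ≡⟨ cong (ℕ._* multiplicity C 0ℤ) (∑ⁿ-cong C n (λ {κ} _ → cong 𝟙 (Solves-substitute substituteZero 0ℤ κ (holdsᵖ-substituteZero κ) T R))) ⟩
    # (map substituteZero T ++ R) ℕ.* multiplicity C 0ℤ
      ∎))

  private
    z : ℤ
    z = + multiplicity C 0ℤ
    l : ℤ
    l = + length C

  mutual
    countPoly-counts : ∀ n cs → eval (countPoly z n cs) l ≡ + # cs
    countPoly-counts zero    cs with Solves []ᵛ cs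
    ... | true  = cong (λ e → + 1 ℤ.+ e) (ℤP.*-zeroʳ l)
    ... | false = refl
    countPoly-counts (suc n) cs =
      trans (countPolyᵖ-counts n (concatMap pivots cs) (concatMap residue cs)) (cong +_ (sym (#-split cs)))

    countPolyᵖ-counts : ∀ n T R → eval (countPolyᵖ z n T R) l ≡ + #ᵖ T R
    countPolyᵖ-counts n [] R = begin
      eval (X*ₚ countPoly z n R) l  ≡⟨ eval-X*ₚ (countPoly z n R) l ⟩
      l ℤ.* eval (countPoly z n R) l ≡⟨ cong (l ℤ.*_) (countPoly-counts n R) ⟩
      l ℤ.* + # R                    ≡⟨ sym (ℤP.pos-* (length C) (# R)) ⟩
      + (length C ℕ.* # R)           ≡⟨ cong +_ (sym (#ᵖ-[] R)) ⟩
      + #ᵖ [] R                      ∎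
    countPolyᵖ-counts n (to w s ∷ T) R = begin
      eval (countPolyᵖ z n T R -ₚ countPoly z n S) l               ≡⟨ eval--ₚ (countPolyᵖ z n T R) (countPoly z n S) l ⟩
      eval (countPolyᵖ z n T R) l ℤ.- eval (countPoly z n S) l     ≡⟨ cong₂ ℤ._-_ (countPolyᵖ-counts n T R) (countPoly-counts n S) ⟩
      + #ᵖ T R ℤ.- + # S                                           ≡⟨ subtract-count (# S) (#ᵖ-to w s T R) ⟩
      + #ᵖ (to w s ∷ T) R                                          ∎
      where S = map (substitute w s) T ++ R
    countPolyᵖ-counts n (loop Sign.+ ∷ T) R = cong +_ (sym (#ᵖ-loop⁺ T R))
    countPolyᵖ-counts n (loop Sign.- ∷ T) R = begin
      eval (countPolyᵖ z n T R -ₚ z ·ₚ countPoly z n S) l           ≡⟨ eval--ₚ (countPolyᵖ z n T R) (z ·ₚ countPoly z n S) l ⟩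
      eval (countPolyᵖ z n T R) l ℤ.- eval (z ·ₚ countPoly z n S) l ≡⟨ cong (λ e → eval (countPolyᵖ z n T R) l ℤ.- e) (eval-·ₚ z (countPoly z n S) l) ⟩
      eval (countPolyᵖ z n T R) l ℤ.- z ℤ.* eval (countPoly z n S) l
        ≡⟨ cong₂ (λ u v → u ℤ.- z ℤ.* v) (countPolyᵖ-counts n T R) (countPoly-counts n S) ⟩
      + #ᵖ T R ℤ.- z ℤ.* + # S                                     ≡⟨ cong (λ e → + #ᵖ T R ℤ.- e) (trans (ℤP.*-comm z (+ # S)) (sym (ℤP.pos-* (# S) _))) ⟩
      + #ᵖ T R ℤ.- + (# S ℕ.* multiplicity C 0ℤ)                   ≡⟨ subtract-count _ (#ᵖ-loop⁻ T R) ⟩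
      + #ᵖ (loop Sign.- ∷ T) R                                     ∎
      where S = map substituteZero T ++ R

-- The colour sets

∑< : ℕ → (ℕ → ℕ) → ℕ
∑< zero    F = 0
∑< (suc N) F = F 0 ℕ.+ ∑< N (F ∘ suc)

∑<-cong : ∀ N {F G} → (∀ {k} → k < N → F k ≡ G k) → ∑< N F ≡ ∑< N G
∑<-cong zero    F≗G = refl
∑<-cong (suc N) F≗G = cong₂ ℕ._+_ (F≗G (s≤s z≤n)) (∑<-cong N (F≗G ∘ s≤s))

∑<-zero : ∀ N → ∑< N (λ _ → 0) ≡ 0
∑<-zero zero    = refl
∑<-zero (suc N) = ∑<-zero N

∑<-+ : ∀ A B F → ∑< (A ℕ.+ B) F ≡ ∑< A F ℕ.+ ∑< B (λ k → F (A ℕ.+ k))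
∑<-+ zero    B F = refl
∑<-+ (suc A) B F = trans (cong (F 0 ℕ.+_) (∑<-+ A B (F ∘ suc))) (sym (ℕP.+-assoc (F 0) _ _))

∑<-last : ∀ N F → ∑< (suc N) F ≡ ∑< N F ℕ.+ F N
∑<-last N F = begin
  ∑< (suc N) F                         ≡⟨ cong (λ M → ∑< M F) (ℕP.+-comm 1 N) ⟩
  ∑< (N ℕ.+ 1) F                       ≡⟨ ∑<-+ N 1 F ⟩
  ∑< N F ℕ.+ (F (N ℕ.+ 0) ℕ.+ 0)      ≡⟨ cong (∑< N F ℕ.+_) (trans (ℕP.+-identityʳ _) (cong F (ℕP.+-identityʳ N))) ⟩
  ∑< N F ℕ.+ F N                       ∎

∑<-reverse : ∀ N (G : ℕ → ℕ) → ∑< N (λ k → G (N ∸ k)) ≡ ∑< N (G ∘ suc)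
∑<-reverse zero    G = refl
∑<-reverse (suc N) G = begin
  G (suc N) ℕ.+ ∑< N (λ k → G (N ∸ k))  ≡⟨ cong (G (suc N) ℕ.+_) (∑<-reverse N G) ⟩
  G (suc N) ℕ.+ ∑< N (G ∘ suc)          ≡⟨ ℕP.+-comm (G (suc N)) _ ⟩
  ∑< N (G ∘ suc) ℕ.+ G (suc N)          ≡⟨ sym (∑<-last N (G ∘ suc)) ⟩
  ∑< (suc N) (G ∘ suc)                  ∎

∑<-indicator : ∀ N j → j < N → ∑< N (λ k → 𝟙 (k ≡ᵇ j)) ≡ 1
∑<-indicator (suc N) zero    _         = cong suc (∑<-zero N)
∑<-indicator (suc N) (suc j) (s≤s j<N) = ∑<-indicator N j j<N

∑<-initial : ∀ N m → m ≤ N → ∑< N (λ k → 𝟙 (suc k ≤ᵇ m)) ≡ m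
∑<-initial N       zero    _         = ∑<-zero N
∑<-initial (suc N) (suc m) (s≤s m≤N) = cong suc (∑<-initial N m m≤N)

∑-applyUpTo : ∀ {A : Set} (g : ℕ → A) N F → ∑ (applyUpTo g N) F ≡ ∑< N (λ k → F (g k))
∑-applyUpTo g zero    F = refl
∑-applyUpTo g (suc N) F = cong (F (g 0) ℕ.+_) (∑-applyUpTo (g ∘ suc) N F)

offset : ℕ → ℕ → ℤ
offset l k = + k ℤ.- + l

colours-as-filter : ∀ l → colours l ≡ filterᵇ (inC l) (applyUpTo (offset l) (suc (2 ℕ.* l)))
colours-as-filter l = cong (filterᵇ (inC l)) (ListP.map-upTo (offset l) (suc (2 ℕ.* l)))

∣offset∣-below : ∀ l k → k ≤ l → ∣ offset l k ∣ ≡ l ∸ k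
∣offset∣-below l k k≤l = begin
  ∣ + k ℤ.- + l ∣       ≡⟨ cong ∣_∣ (trans (ℤP.m-n≡m⊖n k l) (ℤP.⊖-≤ k≤l)) ⟩
  ∣ - (+ (l ∸ k)) ∣     ≡⟨ ℤP.∣-i∣≡∣i∣ (+ (l ∸ k)) ⟩
  l ∸ k                 ∎

offset-above : ∀ l j → offset l (l ℕ.+ j) ≡ + j
offset-above l j = trans (cong (ℤ._- + l) (ℤP.pos-+ l j)) (cancel (+ l) (+ j))
  where
  cancel : ∀ x y → x ℤ.+ y ℤ.- x ≡ y
  cancel = solve-∀

∑<-symmetric : ∀ l (G : ℕ → ℕ) → ∑< (suc (2 ℕ.* l)) (λ k → G ∣ offset l k ∣) ≡ G 0 ℕ.+ 2 ℕ.* ∑< l (G ∘ suc)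
∑<-symmetric l G = begin
  ∑< (suc (2 ℕ.* l)) H
    ≡⟨ cong (λ N → ∑< N H) (halves l) ⟩
  ∑< (l ℕ.+ suc l) H
    ≡⟨ ∑<-+ l (suc l) H ⟩
  ∑< l H ℕ.+ ∑< (suc l) (λ j → H (l ℕ.+ j))
    ≡⟨ cong₂ ℕ._+_ (∑<-cong l (λ {k} k<l → cong G (∣offset∣-below l k (ℕP.<⇒≤ k<l))))
                   (∑<-cong (suc l) (λ {j} _ → cong (G ∘ ∣_∣) (offset-above l j))) ⟩
  ∑< l (λ k → G (l ∸ k)) ℕ.+ ∑< (suc l) G
    ≡⟨ cong (ℕ._+ ∑< (suc l) G) (∑<-reverse l G) ⟩
  S ℕ.+ (G 0 ℕ.+ S)
    ≡⟨ rearrange S (G 0) ⟩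
  G 0 ℕ.+ 2 ℕ.* S
    ∎
  where
  H : ℕ → ℕ
  H k = G ∣ offset l k ∣
  S : ℕ
  S = ∑< l (G ∘ suc)
  halves : ∀ l → suc (2 ℕ.* l) ≡ l ℕ.+ suc l
  halves = ℕSolver.solve-∀
  rearrange : ∀ s g → s ℕ.+ (g ℕ.+ s) ≡ g ℕ.+ 2 ℕ.* s
  rearrange = ℕSolver.solve-∀

inC-∣∣ : ∀ l z → inC l z ≡ inC l (+ ∣ z ∣)
inC-∣∣ l z with l % 2 ≡ᵇ 0
... | true  = refl
... | false = refl

inC⇒∣∣≤ : ∀ l z → T (inC l z) → ∣ z ∣ ≤ l
inC⇒∣∣≤ l z z∈ = ℕP.≤-trans (ℕP.m≤m+n ∣ z ∣ (∣ z ∣ ℕ.+ 0)) (double≤ l z∈)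
  where
  double≤ : ∀ l → T (inC l z) → 2 ℕ.* ∣ z ∣ ≤ l
  double≤ l z∈ with l % 2 ≡ᵇ 0
  ... | true  = ℕP.≤ᵇ⇒≤ _ l (proj₁ (Equivalence.to BoolP.T-∧ z∈))
  ... | false = ℕP.≤-trans (ℕP.≤ᵇ⇒≤ _ (l ∸ 1) z∈) (ℕP.m∸n≤m l 1)

≤ᵇ-double : ∀ a b → (2 ℕ.* a ≤ᵇ 2 ℕ.* b) ≡ (a ≤ᵇ b)
≤ᵇ-double a b = T-injective
  (λ 2a≤2b → ℕP.≤⇒≤ᵇ {a} {b} (ℕP.*-cancelˡ-≤ 2 (ℕP.≤ᵇ⇒≤ (2 ℕ.* a) (2 ℕ.* b) 2a≤2b)))
  (λ a≤b → ℕP.≤⇒≤ᵇ {2 ℕ.* a} {2 ℕ.* b} (ℕP.*-monoʳ-≤ 2 (ℕP.≤ᵇ⇒≤ a b a≤b)))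

inC-even : ∀ m z → inC (2 ℕ.* m) z ≡ (∣ z ∣ ≤ᵇ m) ∧ not (∣ z ∣ ≡ᵇ 0)
inC-even m z = trans (unfold (2 ℕ.* m) even) (cong (_∧ not (∣ z ∣ ≡ᵇ 0)) (≤ᵇ-double ∣ z ∣ m))
  where
  even : 2 ℕ.* m % 2 ≡ 0
  even = trans (cong (_% 2) (ℕP.*-comm 2 m)) (ℕD.m*n%n≡0 m 2)
  unfold : ∀ l → l % 2 ≡ 0 → inC l z ≡ (2 ℕ.* ∣ z ∣ ≤ᵇ l) ∧ not (∣ z ∣ ≡ᵇ 0)
  unfold l l%2≡0 rewrite l%2≡0 = refl

inC-odd : ∀ m z → inC (suc (2 ℕ.* m)) z ≡ (∣ z ∣ ≤ᵇ m)
inC-odd m z = trans (unfold (suc (2 ℕ.* m)) odd) (≤ᵇ-double ∣ z ∣ m)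
  where
  odd : suc (2 ℕ.* m) % 2 ≡ 1
  odd = trans (cong (λ k → suc k % 2) (ℕP.*-comm 2 m)) (ℕD.[m+kn]%n≡m%n 1 m 2)
  unfold : ∀ l → l % 2 ≡ 1 → inC l z ≡ (2 ℕ.* ∣ z ∣ ≤ᵇ l ∸ 1)
  unfold l l%2≡1 rewrite l%2≡1 = refl

offset-preimage : ∀ l a → ∣ a ∣ ≤ l → Σ[ j ∈ ℕ ] j < suc (2 ℕ.* l) × a ℤ.+ + l ≡ + j
offset-preimage l (+ m) m≤l =
  m ℕ.+ l , s≤s (ℕP.≤-trans (ℕP.+-monoˡ-≤ l m≤l) (ℕP.≤-reflexive (cong (l ℕ.+_) (sym (ℕP.+-identityʳ l))))) , sym (ℤP.pos-+ m l)
offset-preimage l -[1+ m ] m<l =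
  l ∸ suc m , s≤s (ℕP.≤-trans (ℕP.m∸n≤m l (suc m)) (ℕP.m≤m+n l _)) , ℤP.⊖-≥ m<l

offset-hits-once : ∀ l a → ∣ a ∣ ≤ l → ∑< (suc (2 ℕ.* l)) (λ k → 𝟙 (offset l k ==ℤ a)) ≡ 1
offset-hits-once l a ∣a∣≤l with offset-preimage l a ∣a∣≤l
... | j , j<N , a+l≡j = trans (∑<-cong (suc (2 ℕ.* l)) (λ {k} _ → cong 𝟙 (hit k))) (∑<-indicator _ j j<N)
  where
  hit : ∀ k → (offset l k ==ℤ a) ≡ (k ≡ᵇ j)
  hit k = T-injective
    (λ k-l≡a → ℕP.≡⇒≡ᵇ k j (ℤP.+-injective (begin
      + k                  ≡⟨ sym (shift-back (+ k) (+ l)) ⟩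
      offset l k ℤ.+ + l   ≡⟨ cong (ℤ._+ + l) (==ℤ⇒≡ {offset l k} {a} k-l≡a) ⟩
      a ℤ.+ + l            ≡⟨ a+l≡j ⟩
      + j                  ∎)))
    (λ k≡j → ≡⇒==ℤ (begin
      + k ℤ.- + l          ≡⟨ cong (λ i → + i ℤ.- + l) (ℕP.≡ᵇ⇒≡ k j k≡j) ⟩
      + j ℤ.- + l          ≡⟨ cong (ℤ._- + l) (sym a+l≡j) ⟩
      a ℤ.+ + l ℤ.- + l    ≡⟨ shift-forth a (+ l) ⟩
      a                    ∎))
    where
    shift-back : ∀ x y → x ℤ.- y ℤ.+ y ≡ x
    shift-back = solve-∀
    shift-forth : ∀ x y → x ℤ.+ y ℤ.- y ≡ x
    shift-forth = solve-∀

multiplicity-colours : ∀ l a → multiplicity (colours l) a ≡ 𝟙 (inC l a)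
multiplicity-colours l a = begin
  multiplicity (colours l) a
    ≡⟨ cong (λ C → multiplicity C a) (colours-as-filter l) ⟩
  multiplicity (filterᵇ (inC l) (applyUpTo (offset l) N)) a
    ≡⟨ ∑-filterᵇ (inC l) (_==ℤ a) (applyUpTo (offset l) N) ⟩
  ∑ (applyUpTo (offset l) N) (λ x → 𝟙 (inC l x ∧ (x ==ℤ a)))
    ≡⟨ ∑-applyUpTo (offset l) N _ ⟩
  ∑< N (λ k → 𝟙 (inC l (offset l k) ∧ (offset l k ==ℤ a)))
    ≡⟨ ∑<-cong N (λ {k} _ → cong 𝟙 (only-a (offset l k))) ⟩
  ∑< N (λ k → 𝟙 ((offset l k ==ℤ a) ∧ inC l a))
    ≡⟨ count-a (inC l a) refl ⟩
  𝟙 (inC l a)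
    ∎
  where
  N = suc (2 ℕ.* l)
  only-a : ∀ x → inC l x ∧ (x ==ℤ a) ≡ (x ==ℤ a) ∧ inC l a
  only-a x with x ℤ.≟ a
  ... | yes refl = BoolP.∧-identityʳ _
  ... | no _     = BoolP.∧-zeroʳ _
  count-a : ∀ b → inC l a ≡ b → ∑< N (λ k → 𝟙 ((offset l k ==ℤ a) ∧ b)) ≡ 𝟙 b
  count-a false _ = trans (∑<-cong N (λ {k} _ → cong 𝟙 (BoolP.∧-zeroʳ (offset l k ==ℤ a)))) (∑<-zero N)
  count-a true  a∈ = trans (∑<-cong N (λ {k} _ → cong 𝟙 (BoolP.∧-identityʳ (offset l k ==ℤ a))))
                           (offset-hits-once l a (inC⇒∣∣≤ l a (Equivalence.from BoolP.T-≡ a∈)))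

colours-symmetric : ∀ l → Symmetric (colours l)
colours-symmetric l {c} c∈C = once c c∈ , once (- c) (trans (inC-neg c) c∈)
  where
  inC-neg : ∀ c → inC l (- c) ≡ inC l c
  inC-neg c = trans (inC-∣∣ l (- c)) (trans (cong (inC l ∘ +_) (ℤP.∣-i∣≡∣i∣ c)) (sym (inC-∣∣ l c)))
  c∈ : inC l c ≡ true
  c∈ = Equivalence.to BoolP.T-≡ (proj₂ (∈P.∈-filter⁻ (λ x → BoolP.T? (inC l x)) {xs = map (offset l) (upTo _)} c∈C))
  once : ∀ x → inC l x ≡ true → multiplicity (colours l) x ≡ 1
  once x x∈ = trans (multiplicity-colours l x) (cong 𝟙 x∈)

length-colours : ∀ l → length (colours l) ≡ 𝟙 (inC l 0ℤ) ℕ.+ 2 ℕ.* ∑< l (λ d → 𝟙 (inC l (+ suc d)))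
length-colours l = begin
  length (colours l)
    ≡⟨ cong length (colours-as-filter l) ⟩
  length (filterᵇ (inC l) (applyUpTo (offset l) (suc (2 ℕ.* l))))
    ≡⟨ length-filterᵇ (inC l) (applyUpTo (offset l) (suc (2 ℕ.* l))) ⟩
  ∑ (applyUpTo (offset l) (suc (2 ℕ.* l))) (λ x → 𝟙 (inC l x))
    ≡⟨ ∑-applyUpTo (offset l) (suc (2 ℕ.* l)) _ ⟩
  ∑< (suc (2 ℕ.* l)) (λ k → 𝟙 (inC l (offset l k)))
    ≡⟨ ∑<-cong (suc (2 ℕ.* l)) (λ {k} _ → cong 𝟙 (inC-∣∣ l (offset l k))) ⟩
  ∑< (suc (2 ℕ.* l)) (λ k → 𝟙 (inC l (+ ∣ offset l k ∣)))
    ≡⟨ ∑<-symmetric l (λ d → 𝟙 (inC l (+ d))) ⟩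
  𝟙 (inC l 0ℤ) ℕ.+ 2 ℕ.* ∑< l (λ d → 𝟙 (inC l (+ suc d)))
    ∎

length-colours-even : ∀ m → length (colours (2 ℕ.* m)) ≡ 2 ℕ.* m
length-colours-even m = begin
  length (colours (2 ℕ.* m))
    ≡⟨ length-colours (2 ℕ.* m) ⟩
  𝟙 (inC (2 ℕ.* m) 0ℤ) ℕ.+ 2 ℕ.* ∑< (2 ℕ.* m) (λ d → 𝟙 (inC (2 ℕ.* m) (+ suc d)))
    ≡⟨ cong₂ (λ z s → z ℕ.+ 2 ℕ.* s) (cong 𝟙 (inC-even m 0ℤ))
             (∑<-cong (2 ℕ.* m) (λ {d} _ → cong 𝟙 (trans (inC-even m (+ suc d)) (BoolP.∧-identityʳ _)))) ⟩
  2 ℕ.* ∑< (2 ℕ.* m) (λ d → 𝟙 (suc d ≤ᵇ m))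
    ≡⟨ cong (2 ℕ.*_) (∑<-initial (2 ℕ.* m) m (ℕP.m≤m+n m _)) ⟩
  2 ℕ.* m
    ∎

length-colours-odd : ∀ m → length (colours (suc (2 ℕ.* m))) ≡ suc (2 ℕ.* m)
length-colours-odd m = begin
  length (colours l)
    ≡⟨ length-colours l ⟩
  𝟙 (inC l 0ℤ) ℕ.+ 2 ℕ.* ∑< l (λ d → 𝟙 (inC l (+ suc d)))
    ≡⟨ cong₂ (λ z s → z ℕ.+ 2 ℕ.* s) (cong 𝟙 (inC-odd m 0ℤ)) (∑<-cong l (λ {d} _ → cong 𝟙 (inC-odd m (+ suc d)))) ⟩
  suc (2 ℕ.* ∑< l (λ d → 𝟙 (suc d ≤ᵇ m)))
    ≡⟨ cong (λ s → suc (2 ℕ.* s)) (∑<-initial l m (ℕP.≤-trans (ℕP.m≤m+n m _) (ℕP.n≤1+n _))) ⟩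
  suc (2 ℕ.* m)
    ∎
  where l = suc (2 ℕ.* m)

multiplicity-zero-even : ∀ m → multiplicity (colours (2 ℕ.* m)) 0ℤ ≡ 0
multiplicity-zero-even m = trans (multiplicity-colours (2 ℕ.* m) 0ℤ) (cong 𝟙 (inC-even m 0ℤ))

multiplicity-zero-odd : ∀ m → multiplicity (colours (suc (2 ℕ.* m))) 0ℤ ≡ 1
multiplicity-zero-odd m = trans (multiplicity-colours (suc (2 ℕ.* m)) 0ℤ) (cong 𝟙 (inC-odd m 0ℤ))

-- Proper colourings as solutions

edgeConstraints : ∀ {n} → Fin n → Fin n → EdgeLabel → List (Constraint n)
edgeConstraints i j noEdge = []
edgeConstraints i j pos    = [ i ≠[ Sign.+ ] j ]
edgeConstraints i j neg    = [ i ≠[ Sign.- ] j ]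

constraints : ∀ {n} → SignedGraph n → List (Constraint n)
constraints {n} Σ = concatMap (λ i → concatMap (λ j → edgeConstraints i j (lab Σ i j)) (allFin n)) (allFin n)

module _ {n} (Σ : SignedGraph n) {P : Constraint n → Set} where

  constraints⁺ : (∀ i j → All P (edgeConstraints i j (lab Σ i j))) → All P (constraints Σ)
  constraints⁺ edge = AllP.concat⁺ (AllP.map⁺ (All.universal (λ i → AllP.concat⁺ (AllP.map⁺ (All.universal (edge i) (allFin n)))) (allFin n)))

  constraints⁻ : All P (constraints Σ) → ∀ i j → All P (edgeConstraints i j (lab Σ i j))
  constraints⁻ ps i j = All.lookup (AllP.map⁻ (AllP.concat⁻ (inner i))) (∈P.∈-allFin j)
    where
    inner : ∀ i → All P (concatMap (λ j → edgeConstraints i j (lab Σ i j)) (allFin n))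
    inner i = All.lookup (AllP.map⁻ (AllP.concat⁻ ps)) (∈P.∈-allFin i)

proper≡Solves : ∀ {n} (Σ : SignedGraph n) κ → proper Σ κ ≡ Solves κ (constraints Σ)
proper≡Solves {n} Σ κ = sym (begin
  Solves κ (constraints Σ)
    ≡⟨ allB-concatMap (holds κ) _ (allFin n) ⟩
  allB (λ i → Solves κ (concatMap (λ j → edgeConstraints i j (lab Σ i j)) (allFin n))) (allFin n)
    ≡⟨ allB-cong (allFin n) (λ i → allB-concatMap (holds κ) _ (allFin n)) ⟩
  allB (λ i → allB (λ j → Solves κ (edgeConstraints i j (lab Σ i j))) (allFin n)) (allFin n)
    ≡⟨ allB-cong (allFin n) (λ i → allB-cong (allFin n) (λ j → edge (lab Σ i j))) ⟩
  proper Σ κ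
    ∎)
  where
  edge : ∀ {i j} ℓ → Solves κ (edgeConstraints i j ℓ) ≡ edgeOK ℓ (lookup κ i) (lookup κ j)
  edge noEdge = refl
  edge pos    = BoolP.∧-identityʳ _
  edge neg    = BoolP.∧-identityʳ _

length-filterᵇ-assignments : ∀ (C : List ℤ) n (p : Vec ℤ n → Bool) →
                             length (filterᵇ p (assignments n C)) ≡ ∑ⁿ C n (λ κ → 𝟙 (p κ))
length-filterᵇ-assignments C zero    p with p []ᵛ
... | true  = refl
... | false = refl
length-filterᵇ-assignments C (suc n) p = begin
  length (filterᵇ p (assignments (suc n) C))
    ≡⟨ length-filterᵇ p (assignments (suc n) C) ⟩
  ∑ (concatMap (λ c → map (c ∷ᵛ_) (assignments n C)) C) (λ κ → 𝟙 (p κ))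
    ≡⟨ ∑-concatMap (λ c → map (c ∷ᵛ_) (assignments n C)) C _ ⟩
  ∑ C (λ c → ∑ (map (c ∷ᵛ_) (assignments n C)) (λ κ → 𝟙 (p κ)))
    ≡⟨ ∑-cong C (λ {c} _ → ∑-map (c ∷ᵛ_) (assignments n C) _) ⟩
  ∑ C (λ c → ∑ (assignments n C) (λ κ → 𝟙 (p (c ∷ᵛ κ))))
    ≡⟨ ∑-cong C (λ {c} _ → trans (sym (length-filterᵇ _ (assignments n C))) (length-filterᵇ-assignments C n (λ κ → p (c ∷ᵛ κ)))) ⟩
  ∑ⁿ C (suc n) (λ κ → 𝟙 (p κ))
    ∎

f≡solutions : ∀ {n} (Σ : SignedGraph n) l → f Σ l ≡ ∑ⁿ (colours l) n (λ κ → 𝟙 (Solves κ (constraints Σ)))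
f≡solutions {n} Σ l =
  trans (length-filterᵇ-assignments (colours l) n (proper Σ)) (∑ⁿ-cong (colours l) n (λ {κ} _ → cong 𝟙 (proper≡Solves Σ κ)))

-- The value at -1

-- (-1)ⁿ · countPoly z n cs (-1), computed in ℕ so that its monotonicity in z is visible.
mutual
  altCount : ℕ → (n : ℕ) → List (Constraint n) → ℕ
  altCount z zero    cs = 𝟙 (Solves []ᵛ cs)
  altCount z (suc n) cs = altCountᵖ z n (concatMap pivots cs) (concatMap residue cs)

  altCountᵖ : ℕ → (n : ℕ) → List (Pivot n) → List (Constraint n) → ℕ
  altCountᵖ z n []                R = altCount z n R
  altCountᵖ z n (to w s ∷ T)      R = altCountᵖ z n T R ℕ.+ altCount z n (map (substitute w s) T ++ R)
  altCountᵖ z n (loop Sign.+ ∷ T) R = 0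
  altCountᵖ z n (loop Sign.- ∷ T) R = altCountᵖ z n T R ℕ.+ z ℕ.* altCount z n (map substituteZero T ++ R)

private
  flip-twice : ∀ s e → (-1ℤ ℤ.* s) ℤ.* (0ℤ ℤ.+ -1ℤ ℤ.* e) ≡ s ℤ.* e
  flip-twice = solve-∀
  flip-difference : ∀ s a b → (-1ℤ ℤ.* s) ℤ.* (a ℤ.- b) ≡ (-1ℤ ℤ.* s) ℤ.* a ℤ.+ s ℤ.* b
  flip-difference = solve-∀
  flip-scaled : ∀ s a z b → (-1ℤ ℤ.* s) ℤ.* (a ℤ.- z ℤ.* b) ≡ (-1ℤ ℤ.* s) ℤ.* a ℤ.+ z ℤ.* (s ℤ.* b)
  flip-scaled = solve-∀

mutual
  countPoly-at-minus-one : ∀ z n cs → -1ℤ ^ n ℤ.* eval (countPoly (+ z) n cs) -1ℤ ≡ + altCount z n cs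
  countPoly-at-minus-one z zero cs with Solves []ᵛ cs
  ... | true  = refl
  ... | false = refl
  countPoly-at-minus-one z (suc n) cs = countPolyᵖ-at-minus-one z n (concatMap pivots cs) (concatMap residue cs)

  countPolyᵖ-at-minus-one : ∀ z n T R → -1ℤ ^ suc n ℤ.* eval (countPolyᵖ (+ z) n T R) -1ℤ ≡ + altCountᵖ z n T R
  countPolyᵖ-at-minus-one z n [] R =
    trans (flip-twice (-1ℤ ^ n) _) (countPoly-at-minus-one z n R)
  countPolyᵖ-at-minus-one z n (to w s ∷ T) R = begin
    σ ℤ.* eval (countPolyᵖ (+ z) n T R -ₚ countPoly (+ z) n S) -1ℤ
      ≡⟨ cong (σ ℤ.*_) (eval--ₚ (countPolyᵖ (+ z) n T R) (countPoly (+ z) n S) -1ℤ) ⟩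
    σ ℤ.* (eval (countPolyᵖ (+ z) n T R) -1ℤ ℤ.- eval (countPoly (+ z) n S) -1ℤ)
      ≡⟨ flip-difference (-1ℤ ^ n) _ _ ⟩
    σ ℤ.* eval (countPolyᵖ (+ z) n T R) -1ℤ ℤ.+ -1ℤ ^ n ℤ.* eval (countPoly (+ z) n S) -1ℤ
      ≡⟨ cong₂ ℤ._+_ (countPolyᵖ-at-minus-one z n T R) (countPoly-at-minus-one z n S) ⟩
    + altCountᵖ z n T R ℤ.+ + altCount z n S
      ≡⟨ sym (ℤP.pos-+ (altCountᵖ z n T R) (altCount z n S)) ⟩
    + altCountᵖ z n (to w s ∷ T) R
      ∎
    where
    σ = -1ℤ ^ suc n
    S = map (substitute w s) T ++ R
  countPolyᵖ-at-minus-one z n (loop Sign.+ ∷ T) R = ℤP.*-zeroʳ (-1ℤ ^ suc n)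
  countPolyᵖ-at-minus-one z n (loop Sign.- ∷ T) R = begin
    σ ℤ.* eval (countPolyᵖ (+ z) n T R -ₚ + z ·ₚ countPoly (+ z) n S) -1ℤ
      ≡⟨ cong (σ ℤ.*_) (trans (eval--ₚ (countPolyᵖ (+ z) n T R) (+ z ·ₚ countPoly (+ z) n S) -1ℤ)
                              (cong (λ e → eval (countPolyᵖ (+ z) n T R) -1ℤ ℤ.- e) (eval-·ₚ (+ z) (countPoly (+ z) n S) -1ℤ))) ⟩
    σ ℤ.* (eval (countPolyᵖ (+ z) n T R) -1ℤ ℤ.- + z ℤ.* eval (countPoly (+ z) n S) -1ℤ)
      ≡⟨ flip-scaled (-1ℤ ^ n) _ (+ z) _ ⟩
    σ ℤ.* eval (countPolyᵖ (+ z) n T R) -1ℤ ℤ.+ + z ℤ.* (-1ℤ ^ n ℤ.* eval (countPoly (+ z) n S) -1ℤ)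
      ≡⟨ cong₂ (λ a b → a ℤ.+ + z ℤ.* b) (countPolyᵖ-at-minus-one z n T R) (countPoly-at-minus-one z n S) ⟩
    + altCountᵖ z n T R ℤ.+ + z ℤ.* + altCount z n S
      ≡⟨ cong (λ e → + altCountᵖ z n T R ℤ.+ e) (sym (ℤP.pos-* z (altCount z n S))) ⟩
    + altCountᵖ z n T R ℤ.+ + (z ℕ.* altCount z n S)
      ≡⟨ sym (ℤP.pos-+ (altCountᵖ z n T R) _) ⟩
    + altCountᵖ z n (loop Sign.- ∷ T) R
      ∎
    where
    σ = -1ℤ ^ suc n
    S = map substituteZero T ++ R

mutual
  altCount-mono : ∀ n cs → altCount 0 n cs ≤ altCount 1 n cs
  altCount-mono zero    cs = ℕP.≤-refl
  altCount-mono (suc n) cs = altCountᵖ-mono n (concatMap pivots cs) (concatMap residue cs)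

  altCountᵖ-mono : ∀ n T R → altCountᵖ 0 n T R ≤ altCountᵖ 1 n T R
  altCountᵖ-mono n []                R = altCount-mono n R
  altCountᵖ-mono n (to w s ∷ T)      R = ℕP.+-mono-≤ (altCountᵖ-mono n T R) (altCount-mono n _)
  altCountᵖ-mono n (loop Sign.+ ∷ T) R = z≤n
  altCountᵖ-mono n (loop Sign.- ∷ T) R = ℕP.+-mono-≤ (altCountᵖ-mono n T R) z≤n

NoPositiveLoop : ∀ {n} → Constraint n → Set
NoPositiveLoop (a ≠[ s ] b)  = a ≡ b → s ≡ Sign.-
NoPositiveLoop unsatisfiable = ⊥

NoPositiveLoopᵖ : ∀ {n} → Pivot n → Set
NoPositiveLoopᵖ (loop s) = s ≡ Sign.-
NoPositiveLoopᵖ (to w s) = ⊤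

NoPositiveLoop-split : ∀ {n} (cs : List (Constraint (suc n))) → All NoPositiveLoop cs →
                       All NoPositiveLoopᵖ (concatMap pivots cs) × All NoPositiveLoop (concatMap residue cs)
NoPositiveLoop-split cs ok = All-concatMap⁺ pivot-part ok , All-concatMap⁺ residue-part ok
  where
  pivot-part : ∀ {c} → NoPositiveLoop c → All NoPositiveLoopᵖ (pivots c)
  pivot-part {zero  ≠[ s ] zero}  ok = ok refl ∷ []
  pivot-part {zero  ≠[ s ] suc b} ok = tt ∷ []
  pivot-part {suc a ≠[ s ] zero}  ok = tt ∷ []
  pivot-part {suc a ≠[ s ] suc b} ok = []
  residue-part : ∀ {c} → NoPositiveLoop c → All NoPositiveLoop (residue c)
  residue-part {zero  ≠[ s ] b}     ok = []
  residue-part {suc a ≠[ s ] zero}  ok = []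
  residue-part {suc a ≠[ s ] suc b} ok = (ok ∘ cong suc) ∷ []

mutual
  altCount-positive : ∀ n cs → All NoPositiveLoop cs → 1 ≤ altCount 1 n cs
  altCount-positive zero    cs ok = ℕP.≤-reflexive (cong 𝟙 (sym (no-variables cs ok)))
    where
    no-variables : ∀ cs → All NoPositiveLoop cs → Solves []ᵛ cs ≡ true
    no-variables []                   []       = refl
    no-variables ((() ≠[ s ] b) ∷ cs) _
    no-variables (unsatisfiable ∷ cs) (() ∷ _)
  altCount-positive (suc n) cs ok =
    altCountᵖ-positive n (concatMap pivots cs) (concatMap residue cs) (proj₁ split) (proj₂ split)
    where split = NoPositiveLoop-split cs ok

  altCountᵖ-positive : ∀ n T R → All NoPositiveLoopᵖ T → All NoPositiveLoop R → 1 ≤ altCountᵖ 1 n T R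
  altCountᵖ-positive n []                R _          okR = altCount-positive n R okR
  altCountᵖ-positive n (to w s ∷ T)      R (_ ∷ okT)  okR = ℕP.≤-trans (altCountᵖ-positive n T R okT okR) (ℕP.m≤m+n _ _)
  altCountᵖ-positive n (loop Sign.- ∷ T) R (_ ∷ okT)  okR = ℕP.≤-trans (altCountᵖ-positive n T R okT okR) (ℕP.m≤m+n _ _)
  altCountᵖ-positive n (loop Sign.+ ∷ T) R (() ∷ _) _

Respects : ∀ {n} → (Fin n → Sign) → Constraint n → Set
Respects τ (a ≠[ s ] b)  = s ≡ τ a Sign.* τ b
Respects τ unsatisfiable = ⊥

Respectsᵖ : ∀ {n} → (Fin (suc n) → Sign) → Pivot n → Set
Respectsᵖ τ (loop s) = s ≡ Sign.+
Respectsᵖ τ (to w s) = s ≡ τ zero Sign.* τ (suc w)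

Switchable : ∀ {n} → List (Constraint n) → Set
Switchable {n} cs = Σ[ τ ∈ (Fin n → Sign) ] All (Respects τ) cs

Switchableᵖ : ∀ {n} → List (Pivot n) → List (Constraint n) → Set
Switchableᵖ {n} T R = Σ[ τ ∈ (Fin (suc n) → Sign) ] All (Respectsᵖ τ) T × All (Respects (τ ∘ suc)) R

Switchable-join : ∀ {n} (cs : List (Constraint (suc n))) →
                  Switchableᵖ (concatMap pivots cs) (concatMap residue cs) → Switchable cs
Switchable-join cs (τ , respT , respR) = τ , join cs respT respR
  where
  join₁ : ∀ c → All (Respectsᵖ τ) (pivots c) → All (Respects (τ ∘ suc)) (residue c) → Respects τ c
  join₁ (zero  ≠[ s ] zero)  (s≡+ ∷ []) [] = trans s≡+ (sym (SignP.s*s≡+ (τ zero)))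
  join₁ (zero  ≠[ s ] suc b) (r ∷ [])   [] = r
  join₁ (suc a ≠[ s ] zero)  (r ∷ [])   [] = trans r (SignP.*-comm (τ zero) (τ (suc a)))
  join₁ (suc a ≠[ s ] suc b) []         (r ∷ []) = r
  join₁ unsatisfiable        []         (() ∷ [])
  join : ∀ cs → All (Respectsᵖ τ) (concatMap pivots cs) → All (Respects (τ ∘ suc)) (concatMap residue cs) → All (Respects τ) cs
  join []       _     _     = []
  join (c ∷ cs) respT respR =
    join₁ c (proj₁ (AllP.++⁻ (pivots c) respT)) (proj₁ (AllP.++⁻ (residue c) respR))
    ∷ join cs (proj₂ (AllP.++⁻ (pivots c) respT)) (proj₂ (AllP.++⁻ (residue c) respR))

IsLoop : ∀ {n} → Pivot n → Set
IsLoop (loop _) = ⊤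
IsLoop (to _ _) = ⊥

isLoop? : ∀ {n} → Decidable (IsLoop {n})
isLoop? (loop _) = yes tt
isLoop? (to _ _) = no λ ()

IsTwin : ∀ {n} → Fin n → Sign → Pivot n → Set
IsTwin w s (loop _) = ⊥
IsTwin w s (to u t) = u ≡ w × t ≡ s

isTwin? : ∀ {n} (w : Fin n) s → Decidable (IsTwin w s)
isTwin? w s (loop _) = no λ ()
isTwin? w s (to u t) with u Fin.≟ w | t SignP.≟ s
... | yes u≡w | yes t≡s = yes (u≡w , t≡s)
... | no u≢w  | _       = no (u≢w ∘ proj₁)
... | _       | no t≢s  = no (t≢s ∘ proj₂)

module _ {n} (τ : Fin (suc n) → Sign) where

  loop-unrespected : ∀ {T} → Any IsLoop T → All NoPositiveLoopᵖ T → ¬ All (Respectsᵖ τ) T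
  loop-unrespected loopInT ok resp = conflict (Any.lookup loopInT) (All.lookupAny (All.zip (ok , resp)) loopInT)
    where
    conflict : ∀ p → (NoPositiveLoopᵖ p × Respectsᵖ τ p) × IsLoop p → ⊥
    conflict (loop s) ((s≡- , s≡+) , _) with trans (sym s≡-) s≡+
    ... | ()

  twin-respected : ∀ {w s T} → Any (IsTwin w s) T → All (Respectsᵖ τ) T → Respectsᵖ τ (to w s)
  twin-respected twinInT resp = respected (Any.lookup twinInT) (All.lookupAny resp twinInT)
    where
    respected : ∀ {w s} p → Respectsᵖ τ p × IsTwin w s p → Respectsᵖ τ (to w s)
    respected (to u t) (r , refl , refl) = r

substituteZero-noPositiveLoop : ∀ {n} {T : List (Pivot n)} → ¬ Any IsLoop T → All NoPositiveLoop (map substituteZero T)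
substituteZero-noPositiveLoop {T = T} noLoop = AllP.map⁺ (All.map fine (AllP.¬Any⇒All¬ T noLoop))
  where
  fine : ∀ {p} → ¬ IsLoop p → NoPositiveLoop (substituteZero p)
  fine {loop _} notLoop = notLoop tt
  fine {to _ _} _       = λ _ → refl

substitute-noPositiveLoop : ∀ {n} w s {T : List (Pivot n)} → ¬ Any (IsTwin w s) T → All NoPositiveLoopᵖ T →
                            All NoPositiveLoop (map (substitute w s) T)
substitute-noPositiveLoop w s {T} noTwin ok = AllP.map⁺ (All.zipWith fine (AllP.¬Any⇒All¬ T noTwin , ok))
  where
  fine : ∀ {p} → ¬ IsTwin w s p × NoPositiveLoopᵖ p → NoPositiveLoop (substitute w s p)
  fine {loop t} (_       , t≡-) _   = t≡-
  fine {to u t} (notTwin , _)   w≡u = s≢t⇒s*t≡- s t (λ s≡t → notTwin (sym w≡u , sym s≡t))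

Switchable-extend : ∀ {n} {R : List (Constraint n)} → Switchable R → Switchableᵖ [] R
Switchable-extend (τ , resp) = extend , [] , resp
  where
  extend : Fin (suc _) → Sign
  extend zero    = Sign.+
  extend (suc i) = τ i

Switchable-unsubstitute : ∀ {n} w s T (R : List (Constraint n)) →
                          Switchable (map (substitute w s) T ++ R) → Switchableᵖ (to w s ∷ T) R
Switchable-unsubstitute {n} w s T R (τ′ , resp) = τ , respW ∷ respT , proj₂ split
  where
  split = AllP.++⁻ (map (substitute w s) T) resp
  τ : Fin (suc n) → Sign
  τ zero    = s Sign.* τ′ w
  τ (suc i) = τ′ i
  respW : s ≡ (s Sign.* τ′ w) Sign.* τ′ w
  respW = sym (trans (SignP.*-assoc s (τ′ w) (τ′ w)) (trans (cong (s Sign.*_) (SignP.s*s≡+ (τ′ w))) (SignP.*-identityʳ s)))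
  lift : ∀ p → Respects τ′ (substitute w s p) → Respectsᵖ τ p
  lift (loop t) t≡ww   = trans t≡ww (SignP.s*s≡+ (τ′ w))
  lift (to u t) st≡wu  = begin
    t                              ≡⟨ sym (s*[s*t]≡t s t) ⟩
    s Sign.* (s Sign.* t)          ≡⟨ cong (s Sign.*_) st≡wu ⟩
    s Sign.* (τ′ w Sign.* τ′ u)    ≡⟨ sym (SignP.*-assoc s (τ′ w) (τ′ u)) ⟩
    (s Sign.* τ′ w) Sign.* τ′ u    ∎
  respT : All (Respectsᵖ τ) T
  respT = All.map (λ {p} → lift p) (AllP.map⁻ (proj₁ split))

mutual
  altCount-strict : ∀ n cs → All NoPositiveLoop cs → ¬ Switchable cs → altCount 0 n cs < altCount 1 n cs
  altCount-strict zero    cs ok ¬sw = ⊥-elim (¬sw ((λ ()) , All.map vacuous ok))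
    where
    vacuous : ∀ {c} → NoPositiveLoop c → Respects (λ ()) c
    vacuous {() ≠[ _ ] _}
  altCount-strict (suc n) cs ok ¬sw =
    altCountᵖ-strict n (concatMap pivots cs) (concatMap residue cs) (proj₁ split) (proj₂ split) (¬sw ∘ Switchable-join cs)
    where split = NoPositiveLoop-split cs ok

  -- A further loop, or a twin of the peeled pivot, keeps T itself unswitchable. Otherwise the
  -- substituted system has no positive loops: after a negative loop it contributes 1·(≥ 1)
  -- against 0·(…), and after an edge pivot it inherits the unswitchability.
  altCountᵖ-strict : ∀ n T R → All NoPositiveLoopᵖ T → All NoPositiveLoop R → ¬ Switchableᵖ T R →
                     altCountᵖ 0 n T R < altCountᵖ 1 n T R
  altCountᵖ-strict n [] R _ okR ¬sw = altCount-strict n R okR (¬sw ∘ Switchable-extend)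
  altCountᵖ-strict n (loop Sign.+ ∷ T) R (() ∷ _) _ _
  altCountᵖ-strict n (loop Sign.- ∷ T) R (_ ∷ okT) okR ¬sw with Any.any? isLoop? T
  ... | yes loopInT = ℕP.+-mono-<-≤ (altCountᵖ-strict n T R okT okR ¬swT) z≤n
    where
    ¬swT : ¬ Switchableᵖ T R
    ¬swT (τ , respT , _) = loop-unrespected τ loopInT okT respT
  ... | no noLoop   = ℕP.+-mono-≤-< (altCountᵖ-mono n T R)
                        (ℕP.≤-trans (altCount-positive n S (AllP.++⁺ (substituteZero-noPositiveLoop noLoop) okR))
                                    (ℕP.≤-reflexive (sym (ℕP.*-identityˡ _))))
    where S = map substituteZero T ++ R
  altCountᵖ-strict n (to w s ∷ T) R (_ ∷ okT) okR ¬sw with Any.any? (isTwin? w s) T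
  ... | yes twinInT = ℕP.+-mono-<-≤ (altCountᵖ-strict n T R okT okR ¬swT) (altCount-mono n _)
    where
    ¬swT : ¬ Switchableᵖ T R
    ¬swT (τ , respT , respR) = ¬sw (τ , twin-respected τ twinInT respT ∷ respT , respR)
  ... | no noTwin   = ℕP.+-mono-≤-< (altCountᵖ-mono n T R)
                        (altCount-strict n S (AllP.++⁺ (substitute-noPositiveLoop w s noTwin okT) okR)
                                             (¬sw ∘ Switchable-unsubstitute w s T R))
    where S = map (substitute w s) T ++ R

-- Closed walks

parity : ℕ → Sign
parity zero    = Sign.+
parity (suc k) = Sign.- Sign.* parity k

parity-+ : ∀ a b → parity (a ℕ.+ b) ≡ parity a Sign.* parity b
parity-+ zero    b = refl
parity-+ (suc a) b = trans (cong (Sign.- Sign.*_) (parity-+ a b)) (sym (SignP.*-assoc Sign.- (parity a) (parity b)))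

even⇒parity≡+ : ∀ {k} → Even k → parity k ≡ Sign.+
even⇒parity≡+ (m , refl) = begin
  parity (m ℕ.+ (m ℕ.+ 0))              ≡⟨ parity-+ m (m ℕ.+ 0) ⟩
  parity m Sign.* parity (m ℕ.+ 0)      ≡⟨ cong (λ k → parity m Sign.* parity k) (ℕP.+-identityʳ m) ⟩
  parity m Sign.* parity m              ≡⟨ SignP.s*s≡+ (parity m) ⟩
  Sign.+                                ∎

parity≡+⇒even : ∀ k → parity k ≡ Sign.+ → Even k
parity≡+⇒even zero          _ = 0 , refl
parity≡+⇒even (suc zero)    ()
parity≡+⇒even (suc (suc k)) p with parity≡+⇒even k (trans (sym (s*[s*t]≡t Sign.- (parity k))) p)
... | m , refl = suc m , two-more m
  where
  two-more : ∀ m → suc (suc (2 ℕ.* m)) ≡ 2 ℕ.* suc m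
  two-more = ℕSolver.solve-∀

edgeSign : EdgeLabel → Sign
edgeSign neg = Sign.-
edgeSign _   = Sign.+

label : Sign → EdgeLabel
label Sign.+ = pos
label Sign.- = neg

path : ∀ {N} → List (Fin N) → List (Fin N × Fin N)
path []           = []
path (x ∷ [])     = []
path (x ∷ y ∷ xs) = (x , y) ∷ path (y ∷ xs)

cycleEdges≡path : ∀ {N} (x : Fin N) xs → cycleEdges (x ∷ xs) ≡ path (x ∷ xs ++ [ x ])
cycleEdges≡path x xs = go x xs
  where
  go : ∀ y ys → zip (y ∷ ys) (ys ++ [ x ]) ≡ path (y ∷ ys ++ [ x ])
  go y []       = refl
  go y (z ∷ ys) = cong ((y , z) ∷_) (go z ys)

path-++ : ∀ {N} (xs : List (Fin N)) y ys → path (xs ++ y ∷ ys) ≡ path (xs ++ [ y ]) ++ path (y ∷ ys)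
path-++ []           y ys = refl
path-++ (x ∷ [])     y ys = refl
path-++ (x ∷ z ∷ xs) y ys = cong ((x , z) ∷_) (path-++ (z ∷ xs) y ys)

module ClosedWalks {N : ℕ} (Σ : SignedGraph N) where

  Adj : Fin N × Fin N → Set
  Adj (a , b) = lab Σ a b ≢ noEdge

  open import Data.List.Membership.DecPropositional (Fin._≟_ {N}) using (_∈?_)

  negatives : List (Fin N × Fin N) → ℕ
  negatives es = length (filterᵇ (λ { (a , b) → isNeg (lab Σ a b) }) es)

  parity-negatives-∷ : ∀ a b es → parity (negatives ((a , b) ∷ es)) ≡ edgeSign (lab Σ a b) Sign.* parity (negatives es)
  parity-negatives-∷ a b es with lab Σ a b
  ... | noEdge = refl
  ... | pos    = refl
  ... | neg    = refl

  parity-negatives-++ : ∀ xs ys → parity (negatives (xs ++ ys)) ≡ parity (negatives xs) Sign.* parity (negatives ys)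
  parity-negatives-++ []             ys = refl
  parity-negatives-++ ((a , b) ∷ xs) ys = begin
    parity (negatives ((a , b) ∷ xs ++ ys))                       ≡⟨ parity-negatives-∷ a b (xs ++ ys) ⟩
    edgeSign (lab Σ a b) Sign.* parity (negatives (xs ++ ys))     ≡⟨ cong (edgeSign (lab Σ a b) Sign.*_) (parity-negatives-++ xs ys) ⟩
    edgeSign (lab Σ a b) Sign.* (parity (negatives xs) Sign.* parity (negatives ys))
                                                                  ≡⟨ sym (SignP.*-assoc (edgeSign (lab Σ a b)) _ _) ⟩
    edgeSign (lab Σ a b) Sign.* parity (negatives xs) Sign.* parity (negatives ys)
                                                                  ≡⟨ cong (Sign._* parity (negatives ys)) (sym (parity-negatives-∷ a b xs)) ⟩
    parity (negatives ((a , b) ∷ xs)) Sign.* parity (negatives ys) ∎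

  infixr 5 _++ʷ_

  data Walk : Fin N → Fin N → Sign → Set where
    []   : ∀ {a} → Walk a a Sign.+
    step : ∀ {a c b t s} → lab Σ a c ≡ label t → Walk c b s → Walk a b (t Sign.* s)

  _++ʷ_ : ∀ {a b c s t} → Walk a b s → Walk b c t → Walk a c (s Sign.* t)
  []                        ++ʷ V = V
  step {t = t} {s = s} e W  ++ʷ V = subst (Walk _ _) (sym (SignP.*-assoc t s _)) (step e (W ++ʷ V))

  reverseʷ : ∀ {a b s} → Walk a b s → Walk b a s
  reverseʷ []                                  = []
  reverseʷ (step {a} {c} {t = t} {s = s} e W) =
    subst (Walk _ _) (trans (cong (s Sign.*_) (SignP.*-identityʳ t)) (SignP.*-comm s t))
          (reverseʷ W ++ʷ step (trans (SignedGraph.sym Σ c a) e) [])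

  sources : ∀ {a b s} → Walk a b s → List (Fin N)
  sources []             = []
  sources (step {a} _ W) = a ∷ sources W

  path-sources-∷ : ∀ {a c b s} (W : Walk c b s) → path (a ∷ sources W ++ [ b ]) ≡ (a , c) ∷ path (sources W ++ [ b ])
  path-sources-∷ []         = refl
  path-sources-∷ (step _ _) = refl

  walk-adjacent : ∀ {a b s} (W : Walk a b s) → All Adj (path (sources W ++ [ b ]))
  walk-adjacent []                   = []
  walk-adjacent (step {t = t} e W) =
    subst (All Adj) (sym (path-sources-∷ W)) ((λ noEdge → label≢noEdge t (trans (sym e) noEdge)) ∷ walk-adjacent W)
    where
    label≢noEdge : ∀ t → label t ≢ noEdge
    label≢noEdge Sign.+ ()
    label≢noEdge Sign.- ()

  walk-parity : ∀ {a b s} (W : Walk a b s) → parity (negatives (path (sources W ++ [ b ]))) ≡ s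
  walk-parity []                                   = refl
  walk-parity (step {a} {c} {b} {t} {s} e W) = begin
    parity (negatives (path (a ∷ sources W ++ [ b ])))          ≡⟨ cong (parity ∘ negatives) (path-sources-∷ W) ⟩
    parity (negatives ((a , c) ∷ path (sources W ++ [ b ])))     ≡⟨ parity-negatives-∷ a c _ ⟩
    edgeSign (lab Σ a c) Sign.* parity (negatives (path (sources W ++ [ b ])))
                                                                ≡⟨ cong₂ Sign._*_ (trans (cong edgeSign e) (edgeSign-label t)) (walk-parity W) ⟩
    t Sign.* s                                                  ∎
    where
    edgeSign-label : ∀ t → edgeSign (label t) ≡ t
    edgeSign-label Sign.+ = refl
    edgeSign-label Sign.- = refl

  closedWalk-cycleEdges : ∀ {a s} (W : Walk a a s) → cycleEdges (sources W) ≡ path (sources W ++ [ a ])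
  closedWalk-cycleEdges []               = refl
  closedWalk-cycleEdges (step {a} _ W) = cycleEdges≡path a (sources W)

  Pinched : List (Fin N) → Set
  Pinched L = Σ[ p ∈ List (Fin N) ] Σ[ u ∈ Fin N ] Σ[ q ∈ List (Fin N) ] Σ[ r ∈ List (Fin N) ] L ≡ p ++ u ∷ q ++ u ∷ r

  unique-or-pinched : ∀ L → Unique L ⊎ Pinched L
  unique-or-pinched []      = inj₁ []
  unique-or-pinched (x ∷ L) with x ∈? L
  ... | yes x∈L = let (q , r , L≡) = ∈P.∈-∃++ x∈L in inj₂ ([] , x , q , r , cong (x ∷_) L≡)
  ... | no x∉L with unique-or-pinched L
  ...   | inj₁ uniqueL              = inj₁ (AllP.¬Any⇒All¬ L x∉L ∷ uniqueL)
  ...   | inj₂ (p , u , q , r , L≡) = inj₂ (x ∷ p , u , q , r , cong (x ∷_) L≡)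

  headOr : List (Fin N) → Fin N → Fin N
  headOr []      u = u
  headOr (x ∷ _) _ = x

  cycleEdges-as-path : ∀ p u s → cycleEdges (p ++ u ∷ s) ≡ path ((p ++ u ∷ s) ++ [ headOr p u ])
  cycleEdges-as-path []      u s = cycleEdges≡path u s
  cycleEdges-as-path (x ∷ p) u s = cycleEdges≡path x (p ++ u ∷ s)

  cycleEdges-pinch : ∀ p u q r →
    let A = path (p ++ [ u ]); B = path (u ∷ q ++ [ u ]); C = path (u ∷ r ++ [ headOr p u ]) in
    cycleEdges (p ++ u ∷ q ++ u ∷ r) ≡ A ++ B ++ C × cycleEdges (p ++ u ∷ r) ≡ A ++ C × cycleEdges (u ∷ q) ≡ B
  cycleEdges-pinch p u q r = outer , inner , cycleEdges≡path u q
    where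
    h = headOr p u
    outer = begin
      cycleEdges (p ++ u ∷ q ++ u ∷ r)                    ≡⟨ cycleEdges-as-path p u (q ++ u ∷ r) ⟩
      path ((p ++ u ∷ q ++ u ∷ r) ++ [ h ])               ≡⟨ cong path (trans (ListP.++-assoc p (u ∷ q ++ u ∷ r) [ h ])
                                                                        (cong (λ s → p ++ u ∷ s) (ListP.++-assoc q (u ∷ r) [ h ]))) ⟩
      path (p ++ u ∷ q ++ u ∷ r ++ [ h ])                 ≡⟨ path-++ p u (q ++ u ∷ r ++ [ h ]) ⟩
      path (p ++ [ u ]) ++ path (u ∷ q ++ u ∷ r ++ [ h ]) ≡⟨ cong (path (p ++ [ u ]) ++_) (path-++ (u ∷ q) u (r ++ [ h ])) ⟩
      path (p ++ [ u ]) ++ path (u ∷ q ++ [ u ]) ++ path (u ∷ r ++ [ h ]) ∎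
    inner = begin
      cycleEdges (p ++ u ∷ r)                             ≡⟨ cycleEdges-as-path p u r ⟩
      path ((p ++ u ∷ r) ++ [ h ])                        ≡⟨ cong path (ListP.++-assoc p (u ∷ r) [ h ]) ⟩
      path (p ++ u ∷ r ++ [ h ])                          ≡⟨ path-++ p u (r ++ [ h ]) ⟩
      path (p ++ [ u ]) ++ path (u ∷ r ++ [ h ])          ∎

  pinch-shorter : ∀ p (u : Fin N) q r →
                  length (p ++ u ∷ r) < length (p ++ u ∷ q ++ u ∷ r) × length (u ∷ q) < length (p ++ u ∷ q ++ u ∷ r)
  pinch-shorter p u q r rewrite ListP.length-++ p {u ∷ r} | ListP.length-++ p {u ∷ q ++ u ∷ r} | ListP.length-++ q {u ∷ r} =
    ℕP.+-monoʳ-< (length p) (s≤s (ℕP.m≤n+m (suc (length r)) (length q))) ,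
    ℕP.<-≤-trans (s≤s (s≤s (ℕP.m≤m+n (length q) (length r))))
                 (ℕP.≤-trans (ℕP.≤-reflexive (cong suc (sym (ℕP.+-suc (length q) (length r))))) (ℕP.m≤n+m _ (length p)))

  two-cycle-positive : ∀ a b → parity (negatives (cycleEdges (a ∷ b ∷ []))) ≡ Sign.+
  two-cycle-positive a b = begin
    parity (negatives ((a , b) ∷ (b , a) ∷ []))              ≡⟨ parity-negatives-∷ a b _ ⟩
    edgeSign (lab Σ a b) Sign.* parity (negatives ((b , a) ∷ []))
                                                            ≡⟨ cong (edgeSign (lab Σ a b) Sign.*_) (parity-negatives-∷ b a []) ⟩
    edgeSign (lab Σ a b) Sign.* (edgeSign (lab Σ b a) Sign.* Sign.+)
                                                            ≡⟨ cong (λ ℓ → edgeSign (lab Σ a b) Sign.* (edgeSign ℓ Sign.* Sign.+)) (SignedGraph.sym Σ b a) ⟩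
    edgeSign (lab Σ a b) Sign.* (edgeSign (lab Σ a b) Sign.* Sign.+)
                                                            ≡⟨ cong (edgeSign (lab Σ a b) Sign.*_) (SignP.*-identityʳ _) ⟩
    edgeSign (lab Σ a b) Sign.* edgeSign (lab Σ a b)        ≡⟨ SignP.s*s≡+ (edgeSign (lab Σ a b)) ⟩
    Sign.+                                                  ∎

  module _ (balanced : Balanced Σ) where

    unique-closed-positive : ∀ L → Unique L → All Adj (cycleEdges L) → parity (negatives (cycleEdges L)) ≡ Sign.+
    unique-closed-positive []                _      _            = refl
    unique-closed-positive (a ∷ [])          _      (adj ∷ [])   = ⊥-elim (adj (irrefl Σ a))
    unique-closed-positive (a ∷ b ∷ [])      _      _            = two-cycle-positive a b
    unique-closed-positive (a ∷ b ∷ c ∷ L)   unique adj          =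
      even⇒parity≡+ (balanced (a ∷ b ∷ c ∷ L) (s≤s (s≤s (s≤s z≤n)) , unique , adj))

    -- At a repeated vertex a closed walk splits into two shorter ones with the same edges.
    closed-positive : ∀ k L → length L ≤ k → All Adj (cycleEdges L) → parity (negatives (cycleEdges L)) ≡ Sign.+
    closed-positive zero    [] _ _ = refl
    closed-positive (suc k) L  L≤k adj with unique-or-pinched L
    ... | inj₁ unique = unique-closed-positive L unique adj
    ... | inj₂ (p , u , q , r , refl) = begin
      parity (negatives (cycleEdges (p ++ u ∷ q ++ u ∷ r)))  ≡⟨ cong (parity ∘ negatives) outer ⟩
      parity (negatives (A ++ B ++ C))                      ≡⟨ trans (parity-negatives-++ A (B ++ C)) (cong (parity (negatives A) Sign.*_) (parity-negatives-++ B C)) ⟩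
      pA Sign.* (pB Sign.* pC)                              ≡⟨ cong (λ s → pA Sign.* (s Sign.* pC)) B-positive ⟩
      pA Sign.* pC                                          ≡⟨ trans (sym (parity-negatives-++ A C)) (cong (parity ∘ negatives) (sym inner)) ⟩
      parity (negatives (cycleEdges (p ++ u ∷ r)))           ≡⟨ closed-positive k (p ++ u ∷ r) (ℕP.≤-pred (ℕP.<-≤-trans shorter₁ L≤k)) adj-outer ⟩
      Sign.+                                                ∎
      where
      A = path (p ++ [ u ])
      B = path (u ∷ q ++ [ u ])
      C = path (u ∷ r ++ [ headOr p u ])
      pA = parity (negatives A)
      pB = parity (negatives B)
      pC = parity (negatives C)
      pinch = cycleEdges-pinch p u q r
      outer = proj₁ pinch
      inner = proj₁ (proj₂ pinch)
      shorter₁ = proj₁ (pinch-shorter p u q r)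
      shorter₂ = proj₂ (pinch-shorter p u q r)
      adjABC = AllP.++⁻ A (subst (All Adj) outer adj)
      adj-outer : All Adj (cycleEdges (p ++ u ∷ r))
      adj-outer = subst (All Adj) (sym inner) (AllP.++⁺ (proj₁ adjABC) (AllP.++⁻ʳ B (proj₂ adjABC)))
      B-positive : pB ≡ Sign.+
      B-positive = subst (λ es → parity (negatives es) ≡ Sign.+) (proj₂ (proj₂ pinch))
        (closed-positive k (u ∷ q) (ℕP.≤-pred (ℕP.<-≤-trans shorter₂ L≤k))
          (subst (All Adj) (sym (proj₂ (proj₂ pinch))) (AllP.++⁻ˡ B (proj₂ adjABC))))

    closedWalk-positive : ∀ {a s} → Walk a a s → s ≡ Sign.+
    closedWalk-positive {a} {s} W = begin
      s                                                   ≡⟨ sym (walk-parity W) ⟩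
      parity (negatives (path (sources W ++ [ a ])))       ≡⟨ cong (λ es → parity (negatives es)) (sym (closedWalk-cycleEdges W)) ⟩
      parity (negatives (cycleEdges (sources W)))
        ≡⟨ closed-positive _ (sources W) ℕP.≤-refl (subst (All Adj) (sym (closedWalk-cycleEdges W)) (walk-adjacent W)) ⟩
      Sign.+                                              ∎

module _ {N : ℕ} (Σ : SignedGraph N) where
  open ClosedWalks Σ

  Witnessed : ∀ {n} → (Fin n → Fin N) → Constraint n → Set
  Witnessed ι (a ≠[ s ] b)  = Walk (ι a) (ι b) s
  Witnessed ι unsatisfiable = ⊥

  Witnessedᵖ : ∀ {n} → (Fin (suc n) → Fin N) → Pivot n → Set
  Witnessedᵖ ι (loop s) = Walk (ι zero) (ι zero) s
  Witnessedᵖ ι (to w s) = Walk (ι zero) (ι (suc w)) s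

  Witnessed-split : ∀ {n} (ι : Fin (suc n) → Fin N) {cs} → All (Witnessed ι) cs →
                    All (Witnessedᵖ ι) (concatMap pivots cs) × All (Witnessed (ι ∘ suc)) (concatMap residue cs)
  Witnessed-split ι ws = All-concatMap⁺ pivot-part ws , All-concatMap⁺ residue-part ws
    where
    pivot-part : ∀ {c} → Witnessed ι c → All (Witnessedᵖ ι) (pivots c)
    pivot-part {zero  ≠[ s ] zero}  W = W ∷ []
    pivot-part {zero  ≠[ s ] suc b} W = W ∷ []
    pivot-part {suc a ≠[ s ] zero}  W = reverseʷ W ∷ []
    pivot-part {suc a ≠[ s ] suc b} W = []
    residue-part : ∀ {c} → Witnessed ι c → All (Witnessed (ι ∘ suc)) (residue c)
    residue-part {zero  ≠[ s ] b}     W = []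
    residue-part {suc a ≠[ s ] zero}  W = []
    residue-part {suc a ≠[ s ] suc b} W = W ∷ []

  Witnessed-substitute : ∀ {n} (ι : Fin (suc n) → Fin N) w s p →
                         Witnessedᵖ ι (to w s) → Witnessedᵖ ι p → Witnessed (ι ∘ suc) (substitute w s p)
  Witnessed-substitute ι w s (loop t) V W = subst (Walk _ _) (trans (cong (s Sign.*_) (SignP.*-comm t s)) (s*[s*t]≡t s t))
                                                (reverseʷ V ++ʷ W ++ʷ V)
  Witnessed-substitute ι w s (to u t) V W = reverseʷ V ++ʷ W

  constraints-witnessed : All (Witnessed id) (constraints Σ)
  constraints-witnessed = constraints⁺ Σ (λ i j → edge (lab Σ i j) refl)
    where
    edge : ∀ {i j} ℓ → lab Σ i j ≡ ℓ → All (Witnessed id) (edgeConstraints i j ℓ)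
    edge noEdge _ = []
    edge pos    e = step e [] ∷ []
    edge neg    e = step e [] ∷ []

  constraints-noPositiveLoop : All NoPositiveLoop (constraints Σ)
  constraints-noPositiveLoop = constraints⁺ Σ (λ i j → edge (lab Σ i j) refl)
    where
    pos≢noEdge : pos ≢ noEdge
    pos≢noEdge ()
    edge : ∀ {i j} ℓ → lab Σ i j ≡ ℓ → All NoPositiveLoop (edgeConstraints i j ℓ)
    edge noEdge _ = []
    edge pos    e = (λ { refl → ⊥-elim (pos≢noEdge (trans (sym e) (irrefl Σ _))) }) ∷ []
    edge neg    e = (λ _ → refl) ∷ []

  module _ (balanced : Balanced Σ) where

    -- z only matters at a negative loop at x₀, which would be a negative closed walk of Σ.
    mutual
      countPoly-independent : ∀ z z′ n (ι : Fin n → Fin N) cs → All (Witnessed ι) cs → countPoly z n cs ≡ countPoly z′ n cs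
      countPoly-independent z z′ zero    ι cs ws = refl
      countPoly-independent z z′ (suc n) ι cs ws =
        countPolyᵖ-independent z z′ n ι (concatMap pivots cs) (concatMap residue cs) (proj₁ split) (proj₂ split)
        where split = Witnessed-split ι ws

      countPolyᵖ-independent : ∀ z z′ n (ι : Fin (suc n) → Fin N) T R → All (Witnessedᵖ ι) T → All (Witnessed (ι ∘ suc)) R →
                               countPolyᵖ z n T R ≡ countPolyᵖ z′ n T R
      countPolyᵖ-independent z z′ n ι []                R wT wR = cong X*ₚ_ (countPoly-independent z z′ n (ι ∘ suc) R wR)
      countPolyᵖ-independent z z′ n ι (to w s ∷ T)      R (V ∷ wT) wR =
        cong₂ _-ₚ_ (countPolyᵖ-independent z z′ n ι T R wT wR)
                   (countPoly-independent z z′ n (ι ∘ suc) _ (AllP.++⁺ (AllP.map⁺ (All.map (λ {p} → Witnessed-substitute ι w s p V) wT)) wR))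
      countPolyᵖ-independent z z′ n ι (loop Sign.+ ∷ T) R _ _ = refl
      countPolyᵖ-independent z z′ n ι (loop Sign.- ∷ T) R (W ∷ _) _ with closedWalk-positive balanced W
      ... | ()

lastOr : ∀ {N} → Fin N → List (Fin N) → Fin N
lastOr x []       = x
lastOr x (y ∷ ys) = lastOr y ys

lastOr-snoc : ∀ {N} (x : Fin N) xs y → lastOr x (xs ++ [ y ]) ≡ y
lastOr-snoc x []       y = refl
lastOr-snoc x (z ∷ xs) y = lastOr-snoc z xs y

module _ {N : ℕ} (Σ : SignedGraph N) (τ : Fin N → Sign) (respects : All (Respects τ) (constraints Σ)) where
  open ClosedWalks Σ

  edge-respected : ∀ a b → Adj (a , b) → edgeSign (lab Σ a b) ≡ τ a Sign.* τ b
  edge-respected a b adj = edge (lab Σ a b) adj (constraints⁻ Σ respects a b)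
    where
    edge : ∀ ℓ → ℓ ≢ noEdge → All (Respects τ) (edgeConstraints a b ℓ) → edgeSign ℓ ≡ τ a Sign.* τ b
    edge noEdge ℓ≢noEdge _          = ⊥-elim (ℓ≢noEdge refl)
    edge pos    _        (r ∷ [])   = r
    edge neg    _        (r ∷ [])   = r

  path-parity : ∀ x xs → All Adj (path (x ∷ xs)) → parity (negatives (path (x ∷ xs))) ≡ τ x Sign.* τ (lastOr x xs)
  path-parity x []       []           = sym (SignP.s*s≡+ (τ x))
  path-parity x (y ∷ ys) (adj ∷ adjs) = begin
    parity (negatives ((x , y) ∷ path (y ∷ ys)))                    ≡⟨ parity-negatives-∷ x y _ ⟩
    edgeSign (lab Σ x y) Sign.* parity (negatives (path (y ∷ ys)))  ≡⟨ cong₂ Sign._*_ (edge-respected x y adj) (path-parity y ys adjs) ⟩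
    (τ x Sign.* τ y) Sign.* (τ y Sign.* τ (lastOr y ys))            ≡⟨ telescope (τ x) (τ y) (τ (lastOr y ys)) ⟩
    τ x Sign.* τ (lastOr y ys)                                      ∎

  cycle-positive : ∀ vs → All Adj (cycleEdges vs) → parity (negatives (cycleEdges vs)) ≡ Sign.+
  cycle-positive []      _   = refl
  cycle-positive (v ∷ r) adj = begin
    parity (negatives (cycleEdges (v ∷ r)))       ≡⟨ cong (λ es → parity (negatives es)) (cycleEdges≡path v r) ⟩
    parity (negatives (path (v ∷ r ++ [ v ])))    ≡⟨ path-parity v (r ++ [ v ]) (subst (All Adj) (cycleEdges≡path v r) adj) ⟩
    τ v Sign.* τ (lastOr v (r ++ [ v ]))          ≡⟨ cong (λ u → τ v Sign.* τ u) (lastOr-snoc v r v) ⟩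
    τ v Sign.* τ v                                ≡⟨ SignP.s*s≡+ (τ v) ⟩
    Sign.+                                        ∎

-- E and O

module _ {n : ℕ} (Σ : SignedGraph n) where

  countPoly-evaluates-f : ∀ l → eval (countPoly (+ multiplicity (colours l) 0ℤ) n (constraints Σ)) (+ length (colours l)) ≡ + f Σ l
  countPoly-evaluates-f l =
    trans (Counting.countPoly-counts (colours l) (colours-symmetric l) n (constraints Σ)) (cong +_ (sym (f≡solutions Σ l)))

  countPoly-isE : IsE Σ (countPoly 0ℤ n (constraints Σ))
  countPoly-isE m = subst₂ (λ z x → eval (countPoly z n (constraints Σ)) x ≡ + f Σ (2 ℕ.* m))
                           (cong +_ (multiplicity-zero-even m)) (cong +_ (length-colours-even m)) (countPoly-evaluates-f (2 ℕ.* m))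

  countPoly-isO : IsO Σ (countPoly 1ℤ n (constraints Σ))
  countPoly-isO m = subst₂ (λ z x → eval (countPoly z n (constraints Σ)) x ≡ + f Σ (suc (2 ℕ.* m)))
                           (cong +_ (multiplicity-zero-odd m)) (cong +_ (length-colours-odd m)) (countPoly-evaluates-f (suc (2 ℕ.* m)))

  IsE-unique : ∀ P Q → IsE Σ P → IsE Σ Q → P ≈ₚ Q
  IsE-unique P Q isP isQ = agree-on-unbounded⇒≈ₚ (λ m → 2 ℕ.* suc m) m<2[1+m] P Q (λ m → trans (isP (suc m)) (sym (isQ (suc m))))
    where
    m<2[1+m] : ∀ m → m < 2 ℕ.* suc m
    m<2[1+m] m = ℕP.<-≤-trans (ℕP.n<1+n m) (ℕP.m≤m+n (suc m) _)

  IsO-unique : ∀ P Q → IsO Σ P → IsO Σ Q → P ≈ₚ Q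
  IsO-unique P Q isP isQ = agree-on-unbounded⇒≈ₚ (λ m → suc (2 ℕ.* m)) m<1+2m P Q (λ m → trans (isP m) (sym (isQ m)))
    where
    m<1+2m : ∀ m → m < suc (2 ℕ.* m)
    m<1+2m m = s≤s (ℕP.m≤m+n m _)

  balanced⇒E≡O : Balanced Σ → countPoly 0ℤ n (constraints Σ) ≡ countPoly 1ℤ n (constraints Σ)
  balanced⇒E≡O balanced = countPoly-independent Σ balanced 0ℤ 1ℤ n id (constraints Σ) (constraints-witnessed Σ)

  -- An odd cycle rules out a switching function, making (-1)ⁿ E(-1) < (-1)ⁿ O(-1).
  E≈O⇒balanced : countPoly 0ℤ n (constraints Σ) ≈ₚ countPoly 1ℤ n (constraints Σ) → Balanced Σ
  E≈O⇒balanced E≈O vs cycle with parity (negCount Σ vs) SignP.≟ Sign.+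
  ... | yes even = parity≡+⇒even _ even
  ... | no odd   = ⊥-elim (ℕP.<-irrefl same-value (altCount-strict n cs (constraints-noPositiveLoop Σ) not-switchable))
    where
    cs = constraints Σ
    not-switchable : ¬ Switchable cs
    not-switchable (τ , respects) = odd (cycle-positive Σ τ respects vs (proj₂ (proj₂ cycle)))
    same-value : altCount 0 n cs ≡ altCount 1 n cs
    same-value = ℤP.+-injective (begin
      + altCount 0 n cs                            ≡⟨ sym (countPoly-at-minus-one 0 n cs) ⟩
      -1ℤ ^ n ℤ.* eval (countPoly 0ℤ n cs) -1ℤ     ≡⟨ cong (-1ℤ ^ n ℤ.*_) (≈ₚ⇒eval≡ (countPoly 0ℤ n cs) (countPoly 1ℤ n cs) E≈O -1ℤ) ⟩
      -1ℤ ^ n ℤ.* eval (countPoly 1ℤ n cs) -1ℤ     ≡⟨ countPoly-at-minus-one 1 n cs ⟩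
      + altCount 1 n cs                            ∎)

theorem2p6 : ∀ {n : ℕ} (Σ : SignedGraph n) →
    Balanced Σ ⇔ (∀ E O → IsE Σ E → IsO Σ O → E ≈ₚ O)
theorem2p6 {n} Σ = mk⇔
  (λ balanced E O isE isO i → begin
    coeff E i    ≡⟨ IsE-unique Σ E E₀ isE (countPoly-isE Σ) i ⟩
    coeff E₀ i   ≡⟨ cong (λ P → coeff P i) (balanced⇒E≡O Σ balanced) ⟩
    coeff O₁ i   ≡⟨ IsO-unique Σ O₁ O (countPoly-isO Σ) isO i ⟩
    coeff O i    ∎)
  (λ E≈O → E≈O⇒balanced Σ (E≈O E₀ O₁ (countPoly-isE Σ) (countPoly-isO Σ)))
  where
  E₀ O₁ : Poly
  E₀ = countPoly 0ℤ n (constraints Σ)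
  O₁ = countPoly 1ℤ n (constraints Σ)
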